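{- For $n\in\mathbb{N}_+$ let $U(n,x)=H_2(n-1,x)H_2(n+1,x)-H_2(n,x)^2$. Then: (1) $U(n,x)=V(n,x^2)$ for a polynomial $V(n,x)\in\mathbb{Z}[x]$ of degree $n-1$; (2) $V(1,x)=1$, $V(2,x)=x-1$, $V(3,x)=x^2+3$, and for $n\geq4$, $$V(n,x)=(x+n-3)V(n-1,x)+(n-2)(x+n)V(n-2,x)-(n-3)(n-2)^2V(n-3,x);$$ (3) $\displaystyle\sum_{n=0}^{\infty}\frac{V(n+1,x)}{n!}t^n=\frac{e^{\frac{xt}{1-t}}}{(1+t)\sqrt{1-t^2}}$; (4) writing $V(n,x)=\sum_{i=0}^{n-1}a(i,n)x^i$, we have for all $n\ge1$ (where indices make sense) $$a(0,2n)=-\left(\frac{(2n)!}{2^n n!}\right)^2,\quad a(0,2n+1)=\frac{1}{2n+1}\left(\frac{(2n+1)!}{2^n n!}\right)^2,\quad a(1,2n)=-a(0,2n),\quad a(1,2n+1)=0,$$ and $a(i,n)>0$ for each $i\in\{2,\dots,n-1\}$.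
   Context: $\mathbb{N}_+$ denotes the positive integers. The polynomials $H_2(n,x)\in\mathbb{Z}[x]$ are defined by $H_2(0,x)=1$, $H_2(1,x)=x$ and $H_2(n,x)=xH_2(n-1,x)+(n-1)H_2(n-2,x)$ for $n\ge2$; explicitly $H_2(n,x)=\sum_{j=0}^{\lfloor n/2\rfloor}\frac{n!}{(n-2j)!\,j!\,2^j}x^{n-2j}$. -}

module Defs where

open import Data.Nat as ℕ using (ℕ; zero; suc; _∸_; _!; _^_; NonZero)
open import Data.Nat.Properties using (_!≢0; m*n≢0; m^n≢0)
open import Data.Integer as ℤ using (ℤ; +_)
open import Data.List using (List; []; _∷_)
open import Data.Rational as ℚ using (ℚ; 0ℚ; 1ℚ)
open import Relation.Binary.PropositionalEquality using (_≡_)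
open import Relation.Nullary using (¬_)
open import Data.Product using (_×_; _,_; proj₁)

-- Polynomials in ℤ[x], as coefficient lists (constant term first).

Poly : Set
Poly = List ℤ

coeff : Poly → ℕ → ℤ
coeff []       _       = + 0
coeff (a ∷ p)  zero    = a
coeff (a ∷ p)  (suc i) = coeff p i

_≈ₚ_ : Poly → Poly → Set
p ≈ₚ q = ∀ i → coeff p i ≡ coeff q i

infixl 6 _+ₚ_ _-ₚ_
infixl 7 _*ₚ_ _·ₚ_

_+ₚ_ : Poly → Poly → Poly
[]      +ₚ q       = q
(a ∷ p) +ₚ []      = a ∷ p
(a ∷ p) +ₚ (b ∷ q) = (a ℤ.+ b) ∷ (p +ₚ q)

_·ₚ_ : ℤ → Poly → Poly
c ·ₚ []      = []
c ·ₚ (a ∷ p) = (c ℤ.* a) ∷ (c ·ₚ p)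

-ₚ_ : Poly → Poly
-ₚ p = ℤ.-[1+ 0 ] ·ₚ p

_-ₚ_ : Poly → Poly → Poly
p -ₚ q = p +ₚ (-ₚ q)

_*ₚ_ : Poly → Poly → Poly
[]      *ₚ q = []
(a ∷ p) *ₚ q = (a ·ₚ q) +ₚ (+ 0 ∷ (p *ₚ q))

constₚ : ℤ → Poly
constₚ c = c ∷ []

Xₚ : Poly
Xₚ = + 0 ∷ + 1 ∷ []

-- p(x) ↦ p(x²)
subSq : Poly → Poly
subSq []      = []
subSq (a ∷ p) = a ∷ + 0 ∷ subSq p

HasDegree : Poly → ℕ → Set
HasDegree p d = (¬ coeff p d ≡ + 0) × (∀ i → d ℕ.< i → coeff p i ≡ + 0)

-- H₂(n,x): H₂(0)=1, H₂(1)=x, H₂(n)=x H₂(n-1) + (n-1) H₂(n-2)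

-- H₂pair n = (H₂(n), H₂(n+1))
H₂pair : ℕ → Poly × Poly
H₂pair zero    = constₚ (+ 1) , Xₚ
H₂pair (suc n) with H₂pair n
... | (a , b) = b , (Xₚ *ₚ b +ₚ (+ (suc n)) ·ₚ a)

H₂ : ℕ → Poly
H₂ n = proj₁ (H₂pair n)

-- U(n,x) = H₂(n-1,x) H₂(n+1,x) - H₂(n,x)²   (used for n ≥ 1)
U : ℕ → Poly
U n = H₂ (n ∸ 1) *ₚ H₂ (suc n) -ₚ H₂ n *ₚ H₂ n

-- Formal power series in t with coefficients in ℚ[[x]]:
-- f n i = coefficient of t^n x^i.

Ser : Set
Ser = ℕ → ℕ → ℚ

sumTo : ℕ → (ℕ → ℚ) → ℚ
sumTo zero    f = f 0
sumTo (suc n) f = sumTo n f ℚ.+ f (suc n)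

_≈ₛ_ : Ser → Ser → Set
f ≈ₛ g = ∀ n i → f n i ≡ g n i

infixl 6 _+ₛ_ _-ₛ_
infixl 7 _*ₛ_

_+ₛ_ : Ser → Ser → Ser
(f +ₛ g) n i = f n i ℚ.+ g n i

_-ₛ_ : Ser → Ser → Ser
(f -ₛ g) n i = f n i ℚ.- g n i

_*ₛ_ : Ser → Ser → Ser
(f *ₛ g) n i = sumTo n λ a → sumTo i λ b → f a b ℚ.* g (n ∸ a) (i ∸ b)

mono : ℚ → ℕ → ℕ → Ser
mono c m j n i with m ℕ.≟ n | j ℕ.≟ i
... | Relation.Nullary.yes _ | Relation.Nullary.yes _ = c
... | _ | _ = 0ℚ

oneₛ tₛ xₛ : Ser
oneₛ = mono 1ℚ 0 0
tₛ   = mono 1ℚ 1 0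
xₛ   = mono 1ℚ 0 1

_^ₛ_ : Ser → ℕ → Ser
f ^ₛ zero  = oneₛ
f ^ₛ suc k = f *ₛ (f ^ₛ k)

_/ℕ_ : ℚ → (d : ℕ) → .{{NonZero d}} → ℚ
q /ℕ d = q ℚ.* (+ 1 ℚ./ d)

-- exp(q) = Σ_k q^k / k!, for a series q with zero constant term
-- (then only k ≤ n contributes to the coefficient of t^n)
expₛ : Ser → Ser
expₛ q n i = sumTo n λ k → ((q ^ₛ k) n i /ℕ (k !)) {{k !≢0}}

ℤ→ℚ : ℤ → ℚ
ℤ→ℚ z = z ℚ./ 1

factRatio : ℕ → ℕ → ℚ
factRatio m n = (+ (m !) ℚ./ (2 ^ n ℕ.* n !)) {{m*n≢0 (2 ^ n) (n !) {{m^n≢0 2 n}} {{n !≢0}}}}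

egf : (ℕ → Poly) → Ser
egf V n i = (ℤ→ℚ (coeff (V (suc n)) i) /ℕ (n !)) {{n !≢0}}

{-# OPTIONS --safe #-}
-- The three-term recurrence of H₂ implies, by a polynomial identity, that U(n) = H₂(n−1)H₂(n+1) − H₂(n)² satisfies
-- the recurrence (2) in x²; as U(1), U(2), U(3) are V(1), V(2), V(3) evaluated at x², U(n) = V(n, x²) for all n.
-- Differentiating, with H₂′(n) = n H₂(n−1), gives V′(n+1) = n (V(n) + V′(n)), which yields the degree, the
-- positivity of the coefficients and, with (2) at x = 0, the closed forms of a(0, n) and a(1, n).
-- For (3), the recurrence (2) says that F = Σ V(n+1) tⁿ/n! solves (1−t)²(1+t) F′ = (x(1+t) + (2t−1)(1−t)) F, so
-- F (1+t) s and exp q solve the same first-order linear equation (1−t)²(1+t) Y′ = x(1+t) Y with Y(0) = 1.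
module Submission where

open import Algebra
open import Data.Nat as ℕ using (ℕ; zero; suc; _∸_; _≤_; z≤n; s≤s; _!; _^_)
import Data.Nat.Properties as ℕP
open import Data.Integer as ℤ using (ℤ; +_; -[1+_])
import Data.Integer.Properties as ℤP
open import Data.Rational as ℚ using (ℚ; _/_; 0ℚ; 1ℚ)
import Data.Rational.Properties as ℚP
import Data.Rational.Unnormalised as ℚᵘ
import Data.Rational.Unnormalised.Properties as ℚᵘP
open import Data.List using (List; []; _∷_)
open import Data.Product using (Σ; _×_; _,_; proj₁; proj₂)
open import Data.Sum using (_⊎_; inj₁; inj₂)
open import Relation.Nullary using (¬_)
import Relation.Binary.PropositionalEquality as P
open P using (_≡_)
open import Defs

-- The ring solver of the standard library for an arbitrary commutative ring, with integer coefficients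
-- interpreted through the canonical map ℤ → R.
module IntegerCoefficientSolver {c ℓ} (R : CommutativeRing c ℓ) where
  open CommutativeRing R
  open import Algebra.Properties.Ring ring using (-‿involutive; -0#≈0#; -‿distribˡ-*; -‿distribʳ-*; -‿+-comm)
  open import Algebra.Properties.Semiring.Mult semiring using (×-homo-+; ×1-homo-*) renaming (_×_ to _×ₙ_)
  open import Algebra.Solver.Ring.AlmostCommutativeRing using (fromCommutativeRing; _-Raw-AlmostCommutative⟶_)
  open import Data.Integer.Base using (_◃_; sign; ∣_∣)
  open import Data.Sign as Sign using (Sign)
  open import Data.Maybe using (Maybe; just; nothing)
  open import Relation.Nullary using (yes; no)
  open import Relation.Binary.Reasoning.Setoid setoid

  ι : ℕ → Carrier
  ι n = n ×ₙ 1#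

  ⟦_⟧ℤ : ℤ → Carrier
  ⟦ + n ⟧ℤ = ι n
  ⟦ -[1+ n ] ⟧ℤ = - ι (suc n)

  private
    signed : Sign → Carrier → Carrier
    signed Sign.+ x = x
    signed Sign.- x = - x

    signed-cong : ∀ s {x y} → x ≈ y → signed s x ≈ signed s y
    signed-cong Sign.+ x≈y = x≈y
    signed-cong Sign.- x≈y = -‿cong x≈y

    signed-* : ∀ s t x y → signed (s Sign.* t) (x * y) ≈ signed s x * signed t y
    signed-* Sign.+ Sign.+ x y = refl
    signed-* Sign.+ Sign.- x y = -‿distribʳ-* x y
    signed-* Sign.- Sign.+ x y = -‿distribˡ-* x y
    signed-* Sign.- Sign.- x y = begin
      x * y         ≈⟨ sym (-‿involutive (x * y)) ⟩
      - - (x * y)   ≈⟨ -‿cong (-‿distribˡ-* x y) ⟩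
      - (- x * y)   ≈⟨ -‿distribʳ-* (- x) y ⟩
      - x * - y     ∎

    ⟦◃⟧ : ∀ s n → ⟦ s ◃ n ⟧ℤ ≈ signed s (ι n)
    ⟦◃⟧ Sign.+ zero = refl
    ⟦◃⟧ Sign.- zero = sym -0#≈0#
    ⟦◃⟧ Sign.+ (suc n) = refl
    ⟦◃⟧ Sign.- (suc n) = refl

    ⟦⟧≈signed-∣∣ : ∀ i → ⟦ i ⟧ℤ ≈ signed (sign i) (ι ∣ i ∣)
    ⟦⟧≈signed-∣∣ (+ zero) = refl
    ⟦⟧≈signed-∣∣ (+ suc n) = refl
    ⟦⟧≈signed-∣∣ -[1+ n ] = refl

    ⟦⟧-*-homo : ∀ i j → ⟦ i ℤ.* j ⟧ℤ ≈ ⟦ i ⟧ℤ * ⟦ j ⟧ℤ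
    ⟦⟧-*-homo i j = begin
      ⟦ (sign i Sign.* sign j) ◃ (∣ i ∣ ℕ.* ∣ j ∣) ⟧ℤ   ≈⟨ ⟦◃⟧ (sign i Sign.* sign j) (∣ i ∣ ℕ.* ∣ j ∣) ⟩
      signed (sign i Sign.* sign j) (ι (∣ i ∣ ℕ.* ∣ j ∣)) ≈⟨ signed-cong (sign i Sign.* sign j) (×1-homo-* ∣ i ∣ ∣ j ∣) ⟩
      signed (sign i Sign.* sign j) (ι ∣ i ∣ * ι ∣ j ∣) ≈⟨ signed-* (sign i) (sign j) _ _ ⟩
      signed (sign i) (ι ∣ i ∣) * signed (sign j) (ι ∣ j ∣) ≈⟨ *-cong (⟦⟧≈signed-∣∣ i) (⟦⟧≈signed-∣∣ j) ⟨
      ⟦ i ⟧ℤ * ⟦ j ⟧ℤ                                     ∎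

    [1+a]-[1+b]≈a-b : ∀ a b → (1# + a) - (1# + b) ≈ a - b
    [1+a]-[1+b]≈a-b a b = begin
      (1# + a) + - (1# + b)     ≈⟨ +-congˡ (-‿+-comm 1# b) ⟨
      (1# + a) + (- 1# + - b)   ≈⟨ +-assoc 1# a _ ⟩
      1# + (a + (- 1# + - b))   ≈⟨ +-congˡ (+-assoc a (- 1#) (- b)) ⟨
      1# + ((a + - 1#) + - b)   ≈⟨ +-congˡ (+-congʳ (+-comm a (- 1#))) ⟩
      1# + ((- 1# + a) + - b)   ≈⟨ +-congˡ (+-assoc (- 1#) a (- b)) ⟩
      1# + (- 1# + (a + - b))   ≈⟨ +-assoc 1# (- 1#) _ ⟨
      (1# + - 1#) + (a + - b)   ≈⟨ +-congʳ (-‿inverseʳ 1#) ⟩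
      0# + (a + - b)            ≈⟨ +-identityˡ _ ⟩
      a - b                     ∎

    ⟦⊖⟧ : ∀ m n → ⟦ m ℤ.⊖ n ⟧ℤ ≈ ι m - ι n
    ⟦⊖⟧ zero zero = sym (-‿inverseʳ 0#)
    ⟦⊖⟧ (suc m) zero = sym (trans (+-congˡ -0#≈0#) (+-identityʳ _))
    ⟦⊖⟧ zero (suc n) = sym (+-identityˡ _)
    ⟦⊖⟧ (suc m) (suc n) = begin
      ⟦ suc m ℤ.⊖ suc n ⟧ℤ   ≡⟨ P.cong ⟦_⟧ℤ (ℤP.[1+m]⊖[1+n]≡m⊖n m n) ⟩
      ⟦ m ℤ.⊖ n ⟧ℤ           ≈⟨ ⟦⊖⟧ m n ⟩
      ι m - ι n              ≈⟨ [1+a]-[1+b]≈a-b _ _ ⟨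
      ι (suc m) - ι (suc n)  ∎

    ⟦⟧-+-homo : ∀ i j → ⟦ i ℤ.+ j ⟧ℤ ≈ ⟦ i ⟧ℤ + ⟦ j ⟧ℤ
    ⟦⟧-+-homo -[1+ m ] -[1+ n ] = begin
      - ι (suc (suc (m ℕ.+ n)))   ≡⟨ P.cong (λ k → - ι (suc k)) (ℕP.+-suc m n) ⟨
      - ι (suc m ℕ.+ suc n)       ≈⟨ -‿cong (×-homo-+ 1# (suc m) (suc n)) ⟩
      - (ι (suc m) + ι (suc n))   ≈⟨ -‿+-comm _ _ ⟨
      - ι (suc m) + - ι (suc n)   ∎
    ⟦⟧-+-homo -[1+ m ] (+ n) = trans (⟦⊖⟧ n (suc m)) (+-comm _ _)
    ⟦⟧-+-homo (+ m) -[1+ n ] = ⟦⊖⟧ m (suc n)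
    ⟦⟧-+-homo (+ m) (+ n) = ×-homo-+ 1# m n

    ⟦⟧-‿homo : ∀ i → ⟦ ℤ.- i ⟧ℤ ≈ - ⟦ i ⟧ℤ
    ⟦⟧-‿homo (+ zero) = sym -0#≈0#
    ⟦⟧-‿homo (+ suc n) = refl
    ⟦⟧-‿homo -[1+ n ] = sym (-‿involutive _)

    ℤ-rawRing : RawRing _ _
    ℤ-rawRing = CommutativeRing.rawRing ℤP.+-*-commutativeRing

    ⟦⟧-morphism : ℤ-rawRing -Raw-AlmostCommutative⟶ fromCommutativeRing R
    ⟦⟧-morphism = record
      { ⟦_⟧ = ⟦_⟧ℤ ; +-homo = ⟦⟧-+-homo ; *-homo = ⟦⟧-*-homo ; -‿homo = ⟦⟧-‿homo
      ; 0-homo = refl ; 1-homo = +-identityʳ 1# }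

    ⟦⟧-weaklyDecidable : ∀ i j → Maybe (⟦ i ⟧ℤ ≈ ⟦ j ⟧ℤ)
    ⟦⟧-weaklyDecidable i j with i ℤ.≟ j
    ... | yes P.refl = just refl
    ... | no _ = nothing

  open import Algebra.Solver.Ring ℤ-rawRing (fromCommutativeRing R) ⟦⟧-morphism ⟦⟧-weaklyDecidable public


module FormalPowerSeries {c ℓ} (R : CommutativeRing c ℓ) where
  open CommutativeRing R
  open import Relation.Binary.Reasoning.Setoid setoid
  open import Relation.Binary.Structures using (IsEquivalence)
  open import Algebra.Properties.Semiring.Mult semiring using (×-homo-+)
  open IntegerCoefficientSolver R using (solve; _:*_; _:=_)
  open IntegerCoefficientSolver R public using (ι)

  ∑ : ℕ → (ℕ → Carrier) → Carrier
  ∑ zero f = f 0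
  ∑ (suc n) f = ∑ n f + f (suc n)

  ∑-cong : ∀ n {f g : ℕ → Carrier} → (∀ k → k ℕ.≤ n → f k ≈ g k) → ∑ n f ≈ ∑ n g
  ∑-cong zero f≈g = f≈g 0 z≤n
  ∑-cong (suc n) f≈g = +-cong (∑-cong n (λ k k≤n → f≈g k (ℕP.m≤n⇒m≤1+n k≤n))) (f≈g (suc n) ℕP.≤-refl)

  ∑-cong′ : ∀ n {f g : ℕ → Carrier} → (∀ k → f k ≈ g k) → ∑ n f ≈ ∑ n g
  ∑-cong′ n f≈g = ∑-cong n (λ k _ → f≈g k)

  ∑-+ : ∀ n (f g : ℕ → Carrier) → ∑ n (λ k → f k + g k) ≈ ∑ n f + ∑ n g
  ∑-+ zero f g = refl
  ∑-+ (suc n) f g = trans (+-congʳ (∑-+ n f g)) (interchange _ _ _ _)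
    where open import Algebra.Properties.CommutativeSemigroup +-commutativeSemigroup using (interchange)

  ∑-*ˡ : ∀ n a (f : ℕ → Carrier) → a * ∑ n f ≈ ∑ n (λ k → a * f k)
  ∑-*ˡ zero a f = refl
  ∑-*ˡ (suc n) a f = trans (distribˡ a _ _) (+-congʳ (∑-*ˡ n a f))

  ∑-*ʳ : ∀ n a (f : ℕ → Carrier) → ∑ n f * a ≈ ∑ n (λ k → f k * a)
  ∑-*ʳ n a f = trans (*-comm _ a) (trans (∑-*ˡ n a f) (∑-cong′ n (λ k → *-comm a (f k))))

  ∑-zero : ∀ n {f : ℕ → Carrier} → (∀ k → k ℕ.≤ n → f k ≈ 0#) → ∑ n f ≈ 0#
  ∑-zero zero f≈0 = f≈0 0 z≤n
  ∑-zero (suc n) f≈0 = trans (+-cong (∑-zero n (λ k k≤n → f≈0 k (ℕP.m≤n⇒m≤1+n k≤n))) (f≈0 (suc n) ℕP.≤-refl)) (+-identityʳ 0#)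

  ∑-suc : ∀ n (f : ℕ → Carrier) → ∑ (suc n) f ≈ f 0 + ∑ n (λ k → f (suc k))
  ∑-suc zero f = refl
  ∑-suc (suc n) f = trans (+-congʳ (∑-suc n f)) (+-assoc _ _ _)

  ∑-reverse : ∀ n (f : ℕ → Carrier) → ∑ n f ≈ ∑ n (λ k → f (n ∸ k))
  ∑-reverse zero f = refl
  ∑-reverse (suc n) f = begin
    ∑ n f + f (suc n)                    ≈⟨ +-congʳ (∑-reverse n f) ⟩
    ∑ n (λ k → f (n ∸ k)) + f (suc n)    ≈⟨ +-comm _ _ ⟩
    f (suc n) + ∑ n (λ k → f (n ∸ k))    ≈⟨ ∑-suc n (λ k → f (suc n ∸ k)) ⟨
    ∑ (suc n) (λ k → f (suc n ∸ k))      ∎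

  ∑-comm : ∀ n m (F : ℕ → ℕ → Carrier) → ∑ n (λ a → ∑ m (F a)) ≈ ∑ m (λ b → ∑ n (λ a → F a b))
  ∑-comm zero m F = refl
  ∑-comm (suc n) m F = begin
    ∑ n (λ a → ∑ m (F a)) + ∑ m (F (suc n))                ≈⟨ +-congʳ (∑-comm n m F) ⟩
    ∑ m (λ b → ∑ n (λ a → F a b)) + ∑ m (F (suc n))        ≈⟨ ∑-+ m _ _ ⟨
    ∑ m (λ b → ∑ n (λ a → F a b) + F (suc n) b)            ∎

  ∑-head : ∀ n (f : ℕ → Carrier) → (∀ k → f (suc k) ≈ 0#) → ∑ n f ≈ f 0
  ∑-head zero f _ = refl
  ∑-head (suc n) f f≈0 = trans (+-cong (∑-head n f f≈0) (f≈0 n)) (+-identityʳ _)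

  -- Both sides sum F b d over the triangle b + d ≤ n.
  ∑-triangle : ∀ n (F : ℕ → ℕ → Carrier) →
               ∑ n (λ c → ∑ c (λ b → F b (c ∸ b))) ≈ ∑ n (λ a → ∑ (n ∸ a) (F a))
  ∑-triangle zero F = refl
  ∑-triangle (suc m) F = begin
    ∑ (suc m) (λ c → ∑ c (λ b → F b (c ∸ b)))
      ≈⟨ ∑-suc m _ ⟩
    F 0 0 + ∑ m (λ c → ∑ (suc c) (λ b → F b (suc c ∸ b)))
      ≈⟨ +-congˡ (∑-cong′ m (λ c → ∑-suc c (λ b → F b (suc c ∸ b)))) ⟩
    F 0 0 + ∑ m (λ c → F 0 (suc c) + ∑ c (λ b → F (suc b) (c ∸ b)))
      ≈⟨ +-congˡ (∑-+ m _ _) ⟩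
    F 0 0 + (∑ m (λ c → F 0 (suc c)) + ∑ m (λ c → ∑ c (λ b → F (suc b) (c ∸ b))))
      ≈⟨ +-congˡ (+-congˡ (∑-triangle m (λ a → F (suc a)))) ⟩
    F 0 0 + (∑ m (λ c → F 0 (suc c)) + ∑ m (λ a → ∑ (m ∸ a) (F (suc a))))
      ≈⟨ +-assoc _ _ _ ⟨
    (F 0 0 + ∑ m (λ c → F 0 (suc c))) + ∑ m (λ a → ∑ (m ∸ a) (F (suc a)))
      ≈⟨ +-congʳ (∑-suc m (F 0)) ⟨
    ∑ (suc m) (F 0) + ∑ m (λ a → ∑ (m ∸ a) (F (suc a)))
      ≈⟨ ∑-suc m (λ a → ∑ (suc m ∸ a) (F a)) ⟨
    ∑ (suc m) (λ a → ∑ (suc m ∸ a) (F a)) ∎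

  record Series : Set c where
    no-eta-equality
    constructor mkSeries
    field at : ℕ → Carrier
  open Series public

  infix 4 _≋_
  record _≋_ (f g : Series) : Set ℓ where
    constructor mk≋
    field un : ∀ n → at f n ≈ at g n
  open _≋_ public

  infixl 6 _⊕_
  infixl 7 _⊛_

  _⊕_ : Series → Series → Series
  at (f ⊕ g) n = at f n + at g n

  ⊝_ : Series → Series
  at (⊝ f) n = - at f n

  𝟘 : Series
  at 𝟘 n = 0#

  κ : Carrier → Series
  at (κ a) zero = a
  at (κ a) (suc n) = 0#

  𝟙 : Series
  𝟙 = κ 1#

  _⊛_ : Series → Series → Series
  at (f ⊛ g) n = ∑ n (λ a → at f a * at g (n ∸ a))

  ⊛-cong : ∀ {f f′ g g′} → f ≋ f′ → g ≋ g′ → f ⊛ g ≋ f′ ⊛ g′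
  ⊛-cong f≋f′ g≋g′ = mk≋ λ n → ∑-cong′ n (λ a → *-cong (un f≋f′ a) (un g≋g′ (n ∸ a)))

  ⊛-comm : ∀ f g → f ⊛ g ≋ g ⊛ f
  ⊛-comm f g = mk≋ λ n → trans (∑-reverse n (λ a → at f a * at g (n ∸ a)))
    (∑-cong n (λ k k≤n → trans (*-comm _ _) (*-congʳ (reflexive (P.cong (at g) (ℕP.m∸[m∸n]≡n k≤n))))))

  ⊛-assoc : ∀ f g h → (f ⊛ g) ⊛ h ≋ f ⊛ (g ⊛ h)
  ⊛-assoc f g h = mk≋ λ n → begin
    ∑ n (λ c → ∑ c (λ b → at f b * at g (c ∸ b)) * at h (n ∸ c))
      ≈⟨ ∑-cong′ n (λ c → ∑-*ʳ c _ _) ⟩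
    ∑ n (λ c → ∑ c (λ b → (at f b * at g (c ∸ b)) * at h (n ∸ c)))
      ≈⟨ ∑-cong′ n (λ c → ∑-cong c (λ b b≤c →
           *-congˡ (reflexive (P.cong (λ k → at h (n ∸ k)) (P.sym (ℕP.m+[n∸m]≡n b≤c)))))) ⟩
    ∑ n (λ c → ∑ c (λ b → F n b (c ∸ b)))
      ≈⟨ ∑-triangle n (F n) ⟩
    ∑ n (λ a → ∑ (n ∸ a) (F n a))
      ≈⟨ ∑-cong′ n (λ a → ∑-cong′ (n ∸ a) (λ d →
           trans (*-assoc _ _ _) (*-congˡ (*-congˡ (reflexive (P.cong (at h) (P.sym (ℕP.∸-+-assoc n a d)))))))) ⟩
    ∑ n (λ a → ∑ (n ∸ a) (λ d → at f a * (at g d * at h (n ∸ a ∸ d))))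
      ≈⟨ ∑-cong′ n (λ a → ∑-*ˡ (n ∸ a) _ _) ⟨
    ∑ n (λ a → at f a * ∑ (n ∸ a) (λ d → at g d * at h (n ∸ a ∸ d))) ∎
    where
    F : ℕ → ℕ → ℕ → Carrier
    F n b d = (at f b * at g d) * at h (n ∸ (b ℕ.+ d))

  ⊛-distribˡ : ∀ f g h → f ⊛ (g ⊕ h) ≋ f ⊛ g ⊕ f ⊛ h
  ⊛-distribˡ f g h = mk≋ λ n → trans (∑-cong′ n (λ a → distribˡ _ _ _)) (∑-+ n _ _)

  ⊛-distribʳ : ∀ f g h → (g ⊕ h) ⊛ f ≋ g ⊛ f ⊕ h ⊛ f
  ⊛-distribʳ f g h = mk≋ λ n → trans (∑-cong′ n (λ a → distribʳ _ _ _)) (∑-+ n _ _)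

  infixr 8 _·_
  _·_ : Carrier → Series → Series
  at (a · f) n = a * at f n

  κ-⊛ : ∀ a f → κ a ⊛ f ≋ a · f
  κ-⊛ a f = mk≋ λ n → ∑-head n _ (λ k → zeroˡ _)

  ⊛-identityˡ : ∀ f → 𝟙 ⊛ f ≋ f
  ⊛-identityˡ f = mk≋ λ n → trans (un (κ-⊛ 1# f) n) (*-identityˡ _)

  ⊛-identityʳ : ∀ f → f ⊛ 𝟙 ≋ f
  ⊛-identityʳ f = mk≋ λ n → trans (un (⊛-comm f 𝟙) n) (un (⊛-identityˡ f) n)

  ≋-isEquivalence : IsEquivalence _≋_
  ≋-isEquivalence = record
    { refl = mk≋ λ n → refl
    ; sym = λ f≋g → mk≋ λ n → sym (un f≋g n)
    ; trans = λ f≋g g≋h → mk≋ λ n → trans (un f≋g n) (un g≋h n)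
    }

  seriesRing : CommutativeRing c ℓ
  seriesRing = record
    { Carrier = Series ; _≈_ = _≋_ ; _+_ = _⊕_ ; _*_ = _⊛_ ; -_ = ⊝_ ; 0# = 𝟘 ; 1# = 𝟙
    ; isCommutativeRing = record
      { isRing = record
        { +-isAbelianGroup = record
          { isGroup = record
            { isMonoid = record
              { isSemigroup = record
                { isMagma = record
                  { isEquivalence = ≋-isEquivalence
                  ; ∙-cong = λ f≋f′ g≋g′ → mk≋ λ n → +-cong (un f≋f′ n) (un g≋g′ n) }
                ; assoc = λ f g h → mk≋ λ n → +-assoc (at f n) (at g n) (at h n) }
              ; identity = (λ f → mk≋ λ n → +-identityˡ (at f n)) , (λ f → mk≋ λ n → +-identityʳ (at f n)) }
            ; inverse = (λ f → mk≋ λ n → -‿inverseˡ (at f n)) , (λ f → mk≋ λ n → -‿inverseʳ (at f n))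
            ; ⁻¹-cong = λ f≋g → mk≋ λ n → -‿cong (un f≋g n) }
          ; comm = λ f g → mk≋ λ n → +-comm (at f n) (at g n) }
        ; *-cong = ⊛-cong
        ; *-assoc = ⊛-assoc
        ; *-identity = ⊛-identityˡ , ⊛-identityʳ
        ; distrib = ⊛-distribˡ , ⊛-distribʳ }
      ; *-comm = ⊛-comm } }

  τ : Series
  at τ zero = 0#
  at τ (suc zero) = 1#
  at τ (suc (suc n)) = 0#

  at-τ⊛-suc : ∀ f n → at (τ ⊛ f) (suc n) ≈ at f n
  at-τ⊛-suc f n = begin
    ∑ (suc n) (λ a → at τ a * at f (suc n ∸ a))           ≈⟨ ∑-suc n _ ⟩
    0# * at f (suc n) + ∑ n (λ k → at τ (suc k) * at f (n ∸ k)) ≈⟨ +-congʳ (zeroˡ _) ⟩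
    0# + ∑ n (λ k → at τ (suc k) * at f (n ∸ k))          ≈⟨ +-identityˡ _ ⟩
    ∑ n (λ k → at τ (suc k) * at f (n ∸ k))               ≈⟨ ∑-head n _ (λ k → zeroˡ _) ⟩
    1# * at f n                                           ≈⟨ *-identityˡ _ ⟩
    at f n                                                ∎

  shift : Series → Series
  at (shift f) zero = 0#
  at (shift f) (suc n) = at f n

  shift-cong : ∀ {f g} → f ≋ g → shift f ≋ shift g
  shift-cong f≋g = mk≋ λ { zero → refl ; (suc n) → un f≋g n }

  τ⊛≋shift : ∀ f → τ ⊛ f ≋ shift f
  τ⊛≋shift f = mk≋ λ { zero → zeroˡ _ ; (suc n) → at-τ⊛-suc f n }

  κ-* : ∀ a b → κ (a * b) ≋ κ a ⊛ κ b
  κ-* a b = mk≋ λ { zero → sym (un (κ-⊛ a (κ b)) 0) ; (suc n) → sym (trans (un (κ-⊛ a (κ b)) (suc n)) (zeroʳ a)) }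

  open IntegerCoefficientSolver seriesRing public using () renaming (ι to ιₛ)

  ιₛ≋κ : ∀ k → ιₛ k ≋ κ (ι k)
  ιₛ≋κ zero = mk≋ λ { zero → refl ; (suc n) → refl }
  ιₛ≋κ (suc k) = mk≋ λ { zero → +-congˡ (un (ιₛ≋κ k) 0)
                       ; (suc n) → trans (+-congˡ (un (ιₛ≋κ k) (suc n))) (+-identityˡ 0#) }

  ιₛ-+ : ∀ a b → ιₛ (a ℕ.+ b) ≋ ιₛ a ⊕ ιₛ b
  ιₛ-+ a b = ×ₛ-homo-+ 𝟙 a b
    where open import Algebra.Properties.Semiring.Mult (CommutativeRing.semiring seriesRing)
                        using () renaming (×-homo-+ to ×ₛ-homo-+)

  at-ιₛ⊛ : ∀ k f n → at (ιₛ k ⊛ f) n ≈ ι k * at f n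
  at-ιₛ⊛ k f n = trans (un (⊛-cong {g = f} {g′ = f} (ιₛ≋κ k) (mk≋ λ _ → refl)) n) (un (κ-⊛ (ι k) f) n)

  ∂ : Series → Series
  at (∂ f) n = ι (suc n) * at f (suc n)

  ∂-cong : ∀ {f g} → f ≋ g → ∂ f ≋ ∂ g
  ∂-cong f≋g = mk≋ λ n → *-congˡ (un f≋g (suc n))

  ∂-⊕ : ∀ f g → ∂ (f ⊕ g) ≋ ∂ f ⊕ ∂ g
  ∂-⊕ f g = mk≋ λ n → distribˡ _ _ _

  ∂-⊝ : ∀ f → ∂ (⊝ f) ≋ ⊝ ∂ f
  ∂-⊝ f = mk≋ λ n → sym (-‿distribʳ-* _ _)
    where open import Algebra.Properties.Ring ring using (-‿distribʳ-*)

  ∂-κ : ∀ a → ∂ (κ a) ≋ 𝟘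
  ∂-κ a = mk≋ λ n → zeroʳ _

  ∂-τ : ∂ τ ≋ 𝟙
  ∂-τ = mk≋ λ { zero → trans (*-identityʳ _) (+-identityʳ 1#) ; (suc n) → zeroʳ _ }

  -- Both sides have n-th coefficient Σₐ (a + (n + 1 − a)) f(a) g(n + 1 − a).
  ∂-⊛ : ∀ f g → ∂ (f ⊛ g) ≋ ∂ f ⊛ g ⊕ f ⊛ ∂ g
  ∂-⊛ f g = mk≋ λ n → sym (begin
    ∑ n (λ a → (ι (suc a) * at f (suc a)) * at g (n ∸ a)) + ∑ n (λ a → at f a * (ι (suc (n ∸ a)) * at g (suc (n ∸ a))))
       ≈⟨ +-cong (∑-cong′ n (λ a → *-assoc _ _ _)) (∑-cong n (λ a a≤n → trans (x[yz]≈y[xz] _ _ _)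
            (*-congˡ (*-congˡ (reflexive (P.cong (at g) (P.sym (ℕP.+-∸-assoc 1 a≤n)))))))) ⟩
    ∑ n (λ a → ι (suc a) * W n (suc a)) + ∑ n (λ a → ι (suc (n ∸ a)) * W n a)
       ≈⟨ +-cong (sym (trans (∑-suc n (λ a → ι a * W n a)) (trans (+-congʳ (zeroˡ _)) (+-identityˡ _))))
                 (∑-cong n (λ a a≤n → *-congʳ (reflexive (P.cong ι (P.sym (ℕP.+-∸-assoc 1 a≤n)))))) ⟩
    ∑ (suc n) (λ a → ι a * W n a) + ∑ n (λ a → ι (suc n ∸ a) * W n a)
       ≈⟨ +-congˡ (sym (trans (+-congˡ (trans (*-congʳ (reflexive (P.cong ι (ℕP.n∸n≡0 n)))) (zeroˡ _))) (+-identityʳ _))) ⟩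
    ∑ (suc n) (λ a → ι a * W n a) + ∑ (suc n) (λ a → ι (suc n ∸ a) * W n a)
       ≈⟨ ∑-+ (suc n) _ _ ⟨
    ∑ (suc n) (λ a → ι a * W n a + ι (suc n ∸ a) * W n a)
       ≈⟨ ∑-cong (suc n) (λ a a≤ → trans (sym (distribʳ _ _ _)) (*-congʳ (trans (sym (×-homo-+ 1# a (suc n ∸ a)))
            (reflexive (P.cong ι (ℕP.m+[n∸m]≡n a≤)))))) ⟩
    ∑ (suc n) (λ a → ι (suc n) * W n a)
       ≈⟨ ∑-*ˡ (suc n) _ _ ⟨
    ι (suc n) * ∑ (suc n) (W n) ∎)
    where
    W : ℕ → ℕ → Carrier
    W n a = at f a * at g (suc n ∸ a)
    x[yz]≈y[xz] : ∀ x y z → x * (y * z) ≈ y * (x * z)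
    x[yz]≈y[xz] = solve 3 (λ x y z → x :* (y :* z) := y :* (x :* z)) refl

  private module SR = CommutativeRing seriesRing

  ∂-ιₛ⊛ : ∀ k f → ∂ (ιₛ k ⊛ f) ≋ ιₛ k ⊛ ∂ f
  ∂-ιₛ⊛ k f = SR.trans (∂-⊛ (ιₛ k) f)
    (SR.trans (SR.+-congʳ (SR.trans (SR.*-congʳ (SR.trans (∂-cong (ιₛ≋κ k)) (∂-κ (ι k)))) (SR.zeroˡ f))) (SR.+-identityˡ _))

  ∂τ≋ιₛ1 : ∂ τ ≋ ιₛ 1
  ∂τ≋ιₛ1 = SR.trans ∂-τ (SR.sym (SR.+-identityʳ 𝟙))


module HermiteDeterminant where

  open import Data.Integer using (_-_)
  open import Data.Bool using (Bool; true; false)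
  open import Relation.Nullary using (yes; no)
  open P using (refl)

  module ℤx = FormalPowerSeries ℤP.+-*-commutativeRing
  open ℤx using (Series; at; _≋_; mk≋; un; _⊕_; _⊛_; ⊝_; κ; τ; 𝟙; 𝟘; ∂; shift; shift-cong; τ⊛≋shift)
  module ℤxR = CommutativeRing ℤx.seriesRing
  module ℤxSolver = IntegerCoefficientSolver ℤx.seriesRing
  open ℤxSolver using (solve; _:+_; _:*_; :-_; _:=_; con)
  open import Relation.Binary.Reasoning.Setoid ℤxR.setoid

  -- Polynomials are handled through their coefficient series, with τ in the role of x.
  coeffs : Poly → Series
  at (coeffs p) n = coeff p n

  coeff-+ₚ : ∀ p q i → coeff (p +ₚ q) i ≡ coeff p i ℤ.+ coeff q i
  coeff-+ₚ [] q i = P.sym (ℤP.+-identityˡ _)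
  coeff-+ₚ (a ∷ p) [] i = P.sym (ℤP.+-identityʳ _)
  coeff-+ₚ (a ∷ p) (b ∷ q) zero = refl
  coeff-+ₚ (a ∷ p) (b ∷ q) (suc i) = coeff-+ₚ p q i

  coeff-·ₚ : ∀ c p i → coeff (c ·ₚ p) i ≡ c ℤ.* coeff p i
  coeff-·ₚ c [] i = P.sym (ℤP.*-zeroʳ c)
  coeff-·ₚ c (a ∷ p) zero = refl
  coeff-·ₚ c (a ∷ p) (suc i) = coeff-·ₚ c p i

  coeffs-+ₚ : ∀ p q → coeffs (p +ₚ q) ≋ coeffs p ⊕ coeffs q
  coeffs-+ₚ p q = mk≋ (coeff-+ₚ p q)

  coeffs-·ₚ : ∀ c p → coeffs (c ·ₚ p) ≋ κ c ⊛ coeffs p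
  coeffs-·ₚ c p = mk≋ λ n → P.trans (coeff-·ₚ c p n) (P.sym (un (ℤx.κ-⊛ c (coeffs p)) n))

  coeffs-∷ : ∀ a p → coeffs (a ∷ p) ≋ κ a ⊕ τ ⊛ coeffs p
  coeffs-∷ a p = mk≋ λ { zero → P.sym (ℤP.+-identityʳ a)
                       ; (suc n) → P.sym (P.trans (ℤP.+-identityˡ _) (ℤx.at-τ⊛-suc (coeffs p) n)) }

  coeffs-*ₚ : ∀ p q → coeffs (p *ₚ q) ≋ coeffs p ⊛ coeffs q
  coeffs-*ₚ [] q = mk≋ λ n → P.sym (un (ℤxR.zeroˡ (coeffs q)) n)
  coeffs-*ₚ (a ∷ p) q = begin
    coeffs (a ·ₚ q +ₚ (+ 0 ∷ p *ₚ q))                  ≈⟨ coeffs-+ₚ (a ·ₚ q) _ ⟩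
    coeffs (a ·ₚ q) ⊕ coeffs (+ 0 ∷ p *ₚ q)             ≈⟨ ℤxR.+-cong (coeffs-·ₚ a q) (coeffs-∷ (+ 0) (p *ₚ q)) ⟩
    κ a ⊛ coeffs q ⊕ (κ (+ 0) ⊕ τ ⊛ coeffs (p *ₚ q))    ≈⟨ ℤxR.+-congˡ (ℤxR.+-cong κ0≋𝟘 (ℤxR.*-congˡ (coeffs-*ₚ p q))) ⟩
    κ a ⊛ coeffs q ⊕ (𝟘 ⊕ τ ⊛ (coeffs p ⊛ coeffs q))   ≈⟨ distrib (κ a) τ (coeffs p) (coeffs q) ⟩
    (κ a ⊕ τ ⊛ coeffs p) ⊛ coeffs q                    ≈⟨ ℤxR.*-congʳ (coeffs-∷ a p) ⟨
    coeffs (a ∷ p) ⊛ coeffs q                          ∎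
    where
    κ0≋𝟘 : κ (+ 0) ≋ 𝟘
    κ0≋𝟘 = mk≋ λ { zero → refl ; (suc n) → refl }
    distrib : ∀ A T P Q → A ⊛ Q ⊕ (𝟘 ⊕ T ⊛ (P ⊛ Q)) ≋ (A ⊕ T ⊛ P) ⊛ Q
    distrib = solve 4 (λ A T P Q → A :* Q :+ (con (+ 0) :+ T :* (P :* Q)) := (A :+ T :* P) :* Q) ℤxR.refl

  coeffs-Xₚ : coeffs Xₚ ≋ τ
  coeffs-Xₚ = mk≋ λ { zero → refl ; (suc zero) → refl ; (suc (suc n)) → refl }

  coeffs-constₚ : ∀ c → coeffs (constₚ c) ≋ κ c
  coeffs-constₚ c = mk≋ λ { zero → refl ; (suc n) → refl }

  coeffs-Xₚ+constₚ : ∀ c → coeffs (Xₚ +ₚ constₚ c) ≋ τ ⊕ κ c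
  coeffs-Xₚ+constₚ c = ℤxR.trans (coeffs-+ₚ Xₚ (constₚ c)) (ℤxR.+-cong coeffs-Xₚ (coeffs-constₚ c))

  coeffs-negₚ : ∀ p → coeffs (-ₚ p) ≋ ⊝ coeffs p
  coeffs-negₚ p = mk≋ λ n → P.trans (coeff-·ₚ ℤ.-[1+ 0 ] p n) (ℤP.-1*i≡-i _)

  coeffs--ₚ : ∀ p q → coeffs (p -ₚ q) ≋ coeffs p ⊕ ⊝ coeffs q
  coeffs--ₚ p q = ℤxR.trans (coeffs-+ₚ p (-ₚ q)) (ℤxR.+-congˡ (coeffs-negₚ q))

  isZeroᵇ : Poly → Bool
  isZeroᵇ [] = true
  isZeroᵇ (a ∷ p) with a ℤ.≟ + 0
  ... | yes _ = isZeroᵇ p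
  ... | no _ = false

  equalᵇ : Poly → Poly → Bool
  equalᵇ [] q = isZeroᵇ q
  equalᵇ (a ∷ p) [] = isZeroᵇ (a ∷ p)
  equalᵇ (a ∷ p) (b ∷ q) with a ℤ.≟ b
  ... | yes _ = equalᵇ p q
  ... | no _ = false

  isZeroᵇ-sound : ∀ p → isZeroᵇ p ≡ true → ∀ n → coeff p n ≡ + 0
  isZeroᵇ-sound [] _ n = refl
  isZeroᵇ-sound (a ∷ p) _ n with a ℤ.≟ + 0
  isZeroᵇ-sound (a ∷ p) _ zero | yes a≡0 = a≡0
  isZeroᵇ-sound (a ∷ p) p≡0 (suc n) | yes _ = isZeroᵇ-sound p p≡0 n
  isZeroᵇ-sound (a ∷ p) () n | no _

  equalᵇ-sound : ∀ p q → equalᵇ p q ≡ true → p ≈ₚ q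
  equalᵇ-sound [] q q≡0 n = P.sym (isZeroᵇ-sound q q≡0 n)
  equalᵇ-sound (a ∷ p) [] p≡0 n = isZeroᵇ-sound (a ∷ p) p≡0 n
  equalᵇ-sound (a ∷ p) (b ∷ q) _ n with a ℤ.≟ b
  equalᵇ-sound (a ∷ p) (b ∷ q) _ zero | yes a≡b = a≡b
  equalᵇ-sound (a ∷ p) (b ∷ q) p≡q (suc n) | yes _ = equalᵇ-sound p q p≡q n
  equalᵇ-sound (a ∷ p) (b ∷ q) () n | no _

  ιℤ≡ : ∀ k → ℤx.ι k ≡ + k
  ιℤ≡ zero = refl
  ιℤ≡ (suc k) = P.cong (ℤ._+_ (+ 1)) (ιℤ≡ k)

  ιℤx : ℕ → Series
  ιℤx = ℤx.ιₛ

  ιℤx≋κ : ∀ k → ιℤx k ≋ κ (+ k)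
  ιℤx≋κ k = ℤxR.trans (ℤx.ιₛ≋κ k) (ℤxR.reflexive (P.cong κ (ιℤ≡ k)))

  -- σ acts on coefficient sequences as the substitution x ↦ x².
  σᶠ : (ℕ → ℤ) → ℕ → ℤ
  σᶠ f zero = f 0
  σᶠ f (suc zero) = + 0
  σᶠ f (suc (suc n)) = σᶠ (λ k → f (suc k)) n

  σ : Series → Series
  at (σ g) n = σᶠ (at g) n

  σᶠ-cong : ∀ {f g} → (∀ n → f n ≡ g n) → ∀ n → σᶠ f n ≡ σᶠ g n
  σᶠ-cong f≡g zero = f≡g 0
  σᶠ-cong f≡g (suc zero) = refl
  σᶠ-cong f≡g (suc (suc n)) = σᶠ-cong (λ k → f≡g (suc k)) n

  σᶠ-+ : ∀ f g n → σᶠ (λ k → f k ℤ.+ g k) n ≡ σᶠ f n ℤ.+ σᶠ g n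
  σᶠ-+ f g zero = refl
  σᶠ-+ f g (suc zero) = refl
  σᶠ-+ f g (suc (suc n)) = σᶠ-+ (λ k → f (suc k)) (λ k → g (suc k)) n

  σᶠ-* : ∀ c f n → σᶠ (λ k → c ℤ.* f k) n ≡ c ℤ.* σᶠ f n
  σᶠ-* c f zero = refl
  σᶠ-* c f (suc zero) = P.sym (ℤP.*-zeroʳ c)
  σᶠ-* c f (suc (suc n)) = σᶠ-* c (λ k → f (suc k)) n

  σᶠ-neg : ∀ f n → σᶠ (λ k → ℤ.- f k) n ≡ ℤ.- σᶠ f n
  σᶠ-neg f zero = refl
  σᶠ-neg f (suc zero) = refl
  σᶠ-neg f (suc (suc n)) = σᶠ-neg (λ k → f (suc k)) n

  σᶠ-zero : ∀ n → σᶠ (λ _ → + 0) n ≡ + 0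
  σᶠ-zero zero = refl
  σᶠ-zero (suc zero) = refl
  σᶠ-zero (suc (suc n)) = σᶠ-zero n

  σ-cong : ∀ {f g} → f ≋ g → σ f ≋ σ g
  σ-cong f≋g = mk≋ (σᶠ-cong (un f≋g))

  σ-⊕ : ∀ f g → σ (f ⊕ g) ≋ σ f ⊕ σ g
  σ-⊕ f g = mk≋ (σᶠ-+ (at f) (at g))

  σ-⊝ : ∀ f → σ (⊝ f) ≋ ⊝ σ f
  σ-⊝ f = mk≋ (σᶠ-neg (at f))

  σ-κ⊛ : ∀ c f → σ (κ c ⊛ f) ≋ κ c ⊛ σ f
  σ-κ⊛ c f = ℤxR.trans (σ-cong (ℤx.κ-⊛ c f)) (ℤxR.trans (mk≋ (σᶠ-* c (at f))) (ℤxR.sym (ℤx.κ-⊛ c (σ f))))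

  σ-constant⊛ : ∀ c z f → c ≋ κ z → σ (c ⊛ f) ≋ c ⊛ σ f
  σ-constant⊛ c z f c≋κz = ℤxR.trans (σ-cong (ℤxR.*-congʳ c≋κz)) (ℤxR.trans (σ-κ⊛ z f) (ℤxR.*-congʳ (ℤxR.sym c≋κz)))

  σ-τ⊛ : ∀ f → σ (τ ⊛ f) ≋ τ ⊛ (τ ⊛ σ f)
  σ-τ⊛ f = begin
    σ (τ ⊛ f)            ≈⟨ σ-cong (τ⊛≋shift f) ⟩
    σ (shift f)          ≈⟨ mk≋ (λ { zero → refl ; (suc zero) → refl ; (suc (suc n)) → refl }) ⟩
    shift (shift (σ f))  ≈⟨ ℤxR.trans (τ⊛≋shift (τ ⊛ σ f)) (shift-cong (τ⊛≋shift (σ f))) ⟨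
    τ ⊛ (τ ⊛ σ f)        ∎

  σ-[τ+ι]⊛ : ∀ k f → σ ((τ ⊕ ιℤx k) ⊛ f) ≋ (τ ⊛ τ ⊕ ιℤx k) ⊛ σ f
  σ-[τ+ι]⊛ k f = begin
    σ ((τ ⊕ ιℤx k) ⊛ f)             ≈⟨ σ-cong (ℤxR.distribʳ f τ (ιℤx k)) ⟩
    σ (τ ⊛ f ⊕ ιℤx k ⊛ f)           ≈⟨ σ-⊕ _ _ ⟩
    σ (τ ⊛ f) ⊕ σ (ιℤx k ⊛ f)       ≈⟨ ℤxR.+-cong (σ-τ⊛ f) (σ-constant⊛ (ιℤx k) (+ k) f (ιℤx≋κ k)) ⟩
    τ ⊛ (τ ⊛ σ f) ⊕ ιℤx k ⊛ σ f     ≈⟨ ℤxR.+-congʳ (ℤxR.*-assoc τ τ (σ f)) ⟨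
    τ ⊛ τ ⊛ σ f ⊕ ιℤx k ⊛ σ f       ≈⟨ ℤxR.distribʳ (σ f) (τ ⊛ τ) (ιℤx k) ⟨
    (τ ⊛ τ ⊕ ιℤx k) ⊛ σ f           ∎

  coeffs-subSq : ∀ p → coeffs (subSq p) ≋ σ (coeffs p)
  coeffs-subSq p = mk≋ (coeff-subSq p)
    where
    coeff-subSq : ∀ p n → coeff (subSq p) n ≡ σᶠ (coeff p) n
    coeff-subSq [] n = P.sym (σᶠ-zero n)
    coeff-subSq (a ∷ p) zero = refl
    coeff-subSq (a ∷ p) (suc zero) = refl
    coeff-subSq (a ∷ p) (suc (suc n)) = coeff-subSq p n

  Hs : ℕ → Series
  Hs k = coeffs (H₂ k)

  Hs-0 : Hs 0 ≋ 𝟙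
  Hs-0 = coeffs-constₚ (+ 1)

  Hs-rec : ∀ j → Hs (suc (suc j)) ≋ τ ⊛ Hs (suc j) ⊕ ιℤx (suc j) ⊛ Hs j
  Hs-rec j = begin
    coeffs (Xₚ *ₚ H₂ (suc j) +ₚ (+ suc j) ·ₚ H₂ j)
      ≈⟨ coeffs-+ₚ (Xₚ *ₚ H₂ (suc j)) _ ⟩
    coeffs (Xₚ *ₚ H₂ (suc j)) ⊕ coeffs ((+ suc j) ·ₚ H₂ j)
      ≈⟨ ℤxR.+-cong (ℤxR.trans (coeffs-*ₚ Xₚ (H₂ (suc j))) (ℤxR.*-congʳ coeffs-Xₚ)) (coeffs-·ₚ (+ suc j) (H₂ j)) ⟩
    τ ⊛ Hs (suc j) ⊕ κ (+ suc j) ⊛ Hs j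
      ≈⟨ ℤxR.+-congˡ (ℤxR.*-congʳ (ιℤx≋κ (suc j))) ⟨
    τ ⊛ Hs (suc j) ⊕ ιℤx (suc j) ⊛ Hs j ∎

  -- the recurrence of H₂ in a form valid for every j (the junk value H₂(0 ∸ 1) is multiplied by 0)
  Hs-rec′ : ∀ j → Hs (suc j) ≋ τ ⊛ Hs j ⊕ ιℤx j ⊛ Hs (j ∸ 1)
  Hs-rec′ zero = ℤxR.trans coeffs-Xₚ (ℤxR.sym (ℤxR.trans (ℤxR.+-cong (ℤxR.trans (ℤxR.*-congˡ Hs-0) (ℤxR.*-identityʳ τ))
                                                                       (ℤxR.zeroˡ _))
                                                            (ℤxR.+-identityʳ τ)))
  Hs-rec′ (suc j) = Hs-rec j

  ∂Hs : ∀ j → ∂ (Hs j) ≋ ιℤx j ⊛ Hs (j ∸ 1)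
  ∂Hs zero = ℤxR.trans (ℤx.∂-cong Hs-0) (ℤxR.trans (ℤx.∂-κ (+ 1)) (ℤxR.sym (ℤxR.zeroˡ _)))
  ∂Hs (suc zero) = ℤxR.trans (ℤx.∂-cong coeffs-Xₚ) (ℤxR.trans ℤx.∂τ≋ιₛ1 (ℤxR.sym (ℤxR.trans (ℤxR.*-congˡ Hs-0) (ℤxR.*-identityʳ _))))
  ∂Hs (suc (suc j)) = begin
    ∂ (Hs (suc (suc j)))
      ≈⟨ ℤx.∂-cong (Hs-rec j) ⟩
    ∂ (τ ⊛ Hs (suc j) ⊕ ιℤx (suc j) ⊛ Hs j)
      ≈⟨ ℤx.∂-⊕ _ _ ⟩
    ∂ (τ ⊛ Hs (suc j)) ⊕ ∂ (ιℤx (suc j) ⊛ Hs j)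
      ≈⟨ ℤxR.+-cong (ℤx.∂-⊛ τ _) (ℤx.∂-ιₛ⊛ (suc j) _) ⟩
    ∂ τ ⊛ Hs (suc j) ⊕ τ ⊛ ∂ (Hs (suc j)) ⊕ ιℤx (suc j) ⊛ ∂ (Hs j)
      ≈⟨ ℤxR.+-cong (ℤxR.+-cong (ℤxR.*-cong ℤx.∂τ≋ιₛ1 (Hs-rec′ j))
                                (ℤxR.*-congˡ (ℤxR.trans (∂Hs (suc j)) (ℤxR.*-congʳ (ℤx.ιₛ-+ 1 j)))))
                    (ℤxR.*-cong (ℤx.ιₛ-+ 1 j) (∂Hs j)) ⟩
    ιℤx 1 ⊛ (τ ⊛ Hs j ⊕ ιℤx j ⊛ Hs (j ∸ 1)) ⊕ τ ⊛ ((ιℤx 1 ⊕ ιℤx j) ⊛ Hs j) ⊕ (ιℤx 1 ⊕ ιℤx j) ⊛ (ιℤx j ⊛ Hs (j ∸ 1))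
      ≈⟨ identity τ (ιℤx j) (Hs (j ∸ 1)) (Hs j) ⟩
    (ιℤx 2 ⊕ ιℤx j) ⊛ (τ ⊛ Hs j ⊕ ιℤx j ⊛ Hs (j ∸ 1))
      ≈⟨ ℤxR.*-cong (ℤx.ιₛ-+ 2 j) (Hs-rec′ j) ⟨
    ιℤx (suc (suc j)) ⊛ Hs (suc j) ∎
    where
    identity : ∀ X N H A → ιℤx 1 ⊛ (X ⊛ A ⊕ N ⊛ H) ⊕ X ⊛ ((ιℤx 1 ⊕ N) ⊛ A) ⊕ (ιℤx 1 ⊕ N) ⊛ (N ⊛ H)
                           ≋ (ιℤx 2 ⊕ N) ⊛ (X ⊛ A ⊕ N ⊛ H)
    identity = solve 4 (λ X N H A → con (+ 1) :* (X :* A :+ N :* H) :+ X :* ((con (+ 1) :+ N) :* A) :+ (con (+ 1) :+ N) :* (N :* H)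
                                   := (con (+ 2) :+ N) :* (X :* A :+ N :* H)) ℤxR.refl

  Us : ℕ → Series
  Us k = coeffs (U k)

  Us-def : ∀ k → Us k ≋ Hs (k ∸ 1) ⊛ Hs (suc k) ⊕ ⊝ (Hs k ⊛ Hs k)
  Us-def k = ℤxR.trans (coeffs--ₚ (H₂ (k ∸ 1) *ₚ H₂ (suc k)) (H₂ k *ₚ H₂ k))
                       (ℤxR.+-cong (coeffs-*ₚ (H₂ (k ∸ 1)) _) (ℤxR.-‿cong (coeffs-*ₚ (H₂ k) _)))

  V-step : ℕ → Poly → Poly → Poly → Poly
  V-step n v₁ v₂ v₃ = (Xₚ +ₚ constₚ (+ n - + 3)) *ₚ v₁
                      +ₚ (+ n - + 2) ·ₚ ((Xₚ +ₚ constₚ (+ n)) *ₚ v₂)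
                      -ₚ ((+ n - + 3) ℤ.* ((+ n - + 2) ℤ.* (+ n - + 2))) ·ₚ v₃

  V : ℕ → Poly
  V 0 = []
  V 1 = constₚ (+ 1)
  V 2 = Xₚ -ₚ constₚ (+ 1)
  V 3 = Xₚ *ₚ Xₚ +ₚ constₚ (+ 3)
  V (suc (suc (suc (suc m)))) = V-step (4 ℕ.+ m) (V (suc (suc (suc m)))) (V (suc (suc m))) (V (suc m))

  Vs : ℕ → Series
  Vs k = coeffs (V k)

  -- the right-hand side of the recurrence (2) as a series, with X for x (or x²) and k₁, k₂, k₄ for n − 3, n − 2, n
  Vrec-rhs : (k₁ k₂ k₄ X v₃ v₂ v₁ : Series) → Series
  Vrec-rhs k₁ k₂ k₄ X v₃ v₂ v₁ = (X ⊕ k₁) ⊛ v₃ ⊕ k₂ ⊛ ((X ⊕ k₄) ⊛ v₂) ⊕ ⊝ ((k₁ ⊛ (k₂ ⊛ k₂)) ⊛ v₁)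

  Vrec-rhs-cong : ∀ {k₁ k₁′ k₂ k₂′ k₄ k₄′ v₃ v₃′ v₂ v₂′ v₁ v₁′} X → k₁ ≋ k₁′ → k₂ ≋ k₂′ → k₄ ≋ k₄′ →
                  v₃ ≋ v₃′ → v₂ ≋ v₂′ → v₁ ≋ v₁′ → Vrec-rhs k₁ k₂ k₄ X v₃ v₂ v₁ ≋ Vrec-rhs k₁′ k₂′ k₄′ X v₃′ v₂′ v₁′
  Vrec-rhs-cong X k₁≋ k₂≋ k₄≋ v₃≋ v₂≋ v₁≋ =
    ℤxR.+-cong (ℤxR.+-cong (ℤxR.*-cong (ℤxR.+-congˡ k₁≋) v₃≋) (ℤxR.*-cong k₂≋ (ℤxR.*-cong (ℤxR.+-congˡ k₄≋) v₂≋)))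
               (ℤxR.-‿cong (ℤxR.*-cong (ℤxR.*-cong k₁≋ (ℤxR.*-cong k₂≋ k₂≋)) v₁≋))

  Vs-rec : ∀ m → Vs (4 ℕ.+ m) ≋ Vrec-rhs (ιℤx (1 ℕ.+ m)) (ιℤx (2 ℕ.+ m)) (ιℤx (4 ℕ.+ m)) τ (Vs (3 ℕ.+ m)) (Vs (2 ℕ.+ m)) (Vs (1 ℕ.+ m))
  Vs-rec m = ℤxR.trans (coeffs--ₚ _ _) (ℤxR.+-cong (ℤxR.trans (coeffs-+ₚ _ _) (ℤxR.+-cong first second)) (ℤxR.-‿cong third))
    where
    [X+_]⊛ : ∀ k v → coeffs ((Xₚ +ₚ constₚ (+ k)) *ₚ v) ≋ (τ ⊕ ιℤx k) ⊛ coeffs v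
    [X+ k ]⊛ v = ℤxR.trans (coeffs-*ₚ _ _) (ℤxR.*-congʳ (ℤxR.trans (coeffs-Xₚ+constₚ _) (ℤxR.+-congˡ (ℤxR.sym (ιℤx≋κ k)))))
    first = [X+ 1 ℕ.+ m ]⊛ (V (3 ℕ.+ m))
    second = ℤxR.trans (coeffs-·ₚ _ _) (ℤxR.*-cong (ℤxR.sym (ιℤx≋κ (2 ℕ.+ m))) ([X+ 4 ℕ.+ m ]⊛ (V (2 ℕ.+ m))))
    third = ℤxR.trans (coeffs-·ₚ _ _) (ℤxR.*-congʳ (ℤxR.trans (ℤx.κ-* _ _) (ℤxR.*-cong (ℤxR.sym (ιℤx≋κ (1 ℕ.+ m)))
              (ℤxR.trans (ℤx.κ-* _ _) (ℤxR.*-cong (ℤxR.sym (ιℤx≋κ (2 ℕ.+ m))) (ℤxR.sym (ιℤx≋κ (2 ℕ.+ m))))))))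

  σVs-rec : ∀ m → σ (Vs (4 ℕ.+ m)) ≋ Vrec-rhs (ιℤx (1 ℕ.+ m)) (ιℤx (2 ℕ.+ m)) (ιℤx (4 ℕ.+ m)) (τ ⊛ τ)
                                               (σ (Vs (3 ℕ.+ m))) (σ (Vs (2 ℕ.+ m))) (σ (Vs (1 ℕ.+ m)))
  σVs-rec m = ℤxR.trans (σ-cong (Vs-rec m)) (ℤxR.trans (σ-⊕ _ _) (ℤxR.+-cong (ℤxR.trans (σ-⊕ _ _) (ℤxR.+-cong first second))
                                                                            (ℤxR.trans (σ-⊝ _) (ℤxR.-‿cong third))))
    where
    first = σ-[τ+ι]⊛ (1 ℕ.+ m) _
    second = ℤxR.trans (σ-constant⊛ _ _ _ (ιℤx≋κ (2 ℕ.+ m))) (ℤxR.*-congˡ (σ-[τ+ι]⊛ (4 ℕ.+ m) _))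
    third = σ-constant⊛ _ _ _ (ℤxR.trans (ℤxR.*-cong (ιℤx≋κ (1 ℕ.+ m)) (ℤxR.*-cong (ιℤx≋κ (2 ℕ.+ m)) (ιℤx≋κ (2 ℕ.+ m))))
                                         (ℤxR.sym (ℤxR.trans (ℤx.κ-* _ _) (ℤxR.*-congˡ (ℤx.κ-* _ _)))))

  -- H₂(m+2), …, H₂(m+5) and U(m+1), …, U(m+4) expanded in X = x, M = m, A = H₂(m), B = H₂(m+1).
  -- The operations are parameters, so that the same terms serve as series and as solver syntax.
  module UShapes {T : Set} (plus times : T → T → T) (neg : T → T) (c₁ c₂ c₃ c₄ : T) where
    infixl 6 _+′_
    infixl 7 _*′_
    _+′_ _*′_ : T → T → T
    _+′_ = plus
    _*′_ = times
    h₂ h₃ h₄ h₅ u₁ u₂ u₃ u₄ : T → T → T → T → T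
    h₂ X M A B = X *′ B +′ (c₁ +′ M) *′ A
    h₃ X M A B = X *′ h₂ X M A B +′ (c₂ +′ M) *′ B
    h₄ X M A B = X *′ h₃ X M A B +′ (c₃ +′ M) *′ h₂ X M A B
    h₅ X M A B = X *′ h₄ X M A B +′ (c₄ +′ M) *′ h₃ X M A B
    u₁ X M A B = A *′ h₂ X M A B +′ neg (B *′ B)
    u₂ X M A B = B *′ h₃ X M A B +′ neg (h₂ X M A B *′ h₂ X M A B)
    u₃ X M A B = h₂ X M A B *′ h₄ X M A B +′ neg (h₃ X M A B *′ h₃ X M A B)
    u₄ X M A B = h₃ X M A B *′ h₅ X M A B +′ neg (h₄ X M A B *′ h₄ X M A B)
    rec : T → T → T → T → T → T
    rec X M v₃ v₂ v₁ = (X *′ X +′ (c₁ +′ M)) *′ v₃ +′ (c₂ +′ M) *′ ((X *′ X +′ (c₄ +′ M)) *′ v₂)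
                       +′ neg (((c₁ +′ M) *′ ((c₂ +′ M) *′ (c₂ +′ M))) *′ v₁)

  module UShapesℤx = UShapes _⊕_ _⊛_ ⊝_ (ιℤx 1) (ιℤx 2) (ιℤx 3) (ιℤx 4)
  module UShapesSyntax = UShapes {ℤxSolver.Polynomial 4} _:+_ _:*_ :-_ (con (+ 1)) (con (+ 2)) (con (+ 3)) (con (+ 4))

  -- U itself satisfies the recurrence (2) in x², whatever H₂(m) and H₂(m+1) are.
  U-recurrence : ∀ X M A B → UShapesℤx.u₄ X M A B
                             ≋ UShapesℤx.rec X M (UShapesℤx.u₃ X M A B) (UShapesℤx.u₂ X M A B) (UShapesℤx.u₁ X M A B)
  U-recurrence = solve 4 (λ X M A B → UShapesSyntax.u₄ X M A B
                                      := UShapesSyntax.rec X M (UShapesSyntax.u₃ X M A B) (UShapesSyntax.u₂ X M A B) (UShapesSyntax.u₁ X M A B))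
                         ℤxR.refl

  Us≋σVs-step : ∀ m → Us (1 ℕ.+ m) ≋ σ (Vs (1 ℕ.+ m)) → Us (2 ℕ.+ m) ≋ σ (Vs (2 ℕ.+ m)) → Us (3 ℕ.+ m) ≋ σ (Vs (3 ℕ.+ m))
                  → Us (4 ℕ.+ m) ≋ σ (Vs (4 ℕ.+ m))
  Us≋σVs-step m U₁≋ U₂≋ U₃≋ = begin
    Us (4 ℕ.+ m)
      ≈⟨ u₄ ⟩
    UShapesℤx.u₄ τ M A B
      ≈⟨ U-recurrence τ M A B ⟩
    UShapesℤx.rec τ M (UShapesℤx.u₃ τ M A B) (UShapesℤx.u₂ τ M A B) (UShapesℤx.u₁ τ M A B)
      ≈⟨ Vrec-rhs-cong (τ ⊛ τ) (ℤxR.sym (ℤx.ιₛ-+ 1 m)) (ℤxR.sym (ℤx.ιₛ-+ 2 m)) (ℤxR.sym (ℤx.ιₛ-+ 4 m))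
                       (ℤxR.trans (ℤxR.sym u₃) U₃≋) (ℤxR.trans (ℤxR.sym u₂) U₂≋) (ℤxR.trans (ℤxR.sym u₁) U₁≋) ⟩
    Vrec-rhs (ιℤx (1 ℕ.+ m)) (ιℤx (2 ℕ.+ m)) (ιℤx (4 ℕ.+ m)) (τ ⊛ τ) (σ (Vs (3 ℕ.+ m))) (σ (Vs (2 ℕ.+ m))) (σ (Vs (1 ℕ.+ m)))
      ≈⟨ σVs-rec m ⟨
    σ (Vs (4 ℕ.+ m)) ∎
    where
    M = ιℤx m
    A = Hs m
    B = Hs (suc m)
    h₂ : Hs (2 ℕ.+ m) ≋ UShapesℤx.h₂ τ M A B
    h₂ = ℤxR.trans (Hs-rec m) (ℤxR.+-congˡ (ℤxR.*-congʳ (ℤx.ιₛ-+ 1 m)))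
    h₃ : Hs (3 ℕ.+ m) ≋ UShapesℤx.h₃ τ M A B
    h₃ = ℤxR.trans (Hs-rec (1 ℕ.+ m)) (ℤxR.+-cong (ℤxR.*-congˡ h₂) (ℤxR.*-congʳ (ℤx.ιₛ-+ 2 m)))
    h₄ : Hs (4 ℕ.+ m) ≋ UShapesℤx.h₄ τ M A B
    h₄ = ℤxR.trans (Hs-rec (2 ℕ.+ m)) (ℤxR.+-cong (ℤxR.*-congˡ h₃) (ℤxR.*-cong (ℤx.ιₛ-+ 3 m) h₂))
    h₅ : Hs (5 ℕ.+ m) ≋ UShapesℤx.h₅ τ M A B
    h₅ = ℤxR.trans (Hs-rec (3 ℕ.+ m)) (ℤxR.+-cong (ℤxR.*-congˡ h₄) (ℤxR.*-cong (ℤx.ιₛ-+ 4 m) h₃))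
    u₁ : Us (1 ℕ.+ m) ≋ UShapesℤx.u₁ τ M A B
    u₁ = ℤxR.trans (Us-def (1 ℕ.+ m)) (ℤxR.+-congʳ (ℤxR.*-congˡ h₂))
    u₂ : Us (2 ℕ.+ m) ≋ UShapesℤx.u₂ τ M A B
    u₂ = ℤxR.trans (Us-def (2 ℕ.+ m)) (ℤxR.+-cong (ℤxR.*-congˡ h₃) (ℤxR.-‿cong (ℤxR.*-cong h₂ h₂)))
    u₃ : Us (3 ℕ.+ m) ≋ UShapesℤx.u₃ τ M A B
    u₃ = ℤxR.trans (Us-def (3 ℕ.+ m)) (ℤxR.+-cong (ℤxR.*-cong h₂ h₄) (ℤxR.-‿cong (ℤxR.*-cong h₃ h₃)))
    u₄ : Us (4 ℕ.+ m) ≋ UShapesℤx.u₄ τ M A B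
    u₄ = ℤxR.trans (Us-def (4 ℕ.+ m)) (ℤxR.+-cong (ℤxR.*-cong h₃ h₅) (ℤxR.-‿cong (ℤxR.*-cong h₄ h₄)))

  Us≋σVs-triple : ∀ m → (Us (1 ℕ.+ m) ≋ σ (Vs (1 ℕ.+ m))) × (Us (2 ℕ.+ m) ≋ σ (Vs (2 ℕ.+ m))) × (Us (3 ℕ.+ m) ≋ σ (Vs (3 ℕ.+ m)))
  Us≋σVs-triple zero = by-computation 1 refl , by-computation 2 refl , by-computation 3 refl
    where
    by-computation : ∀ k → equalᵇ (U k) (subSq (V k)) ≡ true → Us k ≋ σ (Vs k)
    by-computation k U≡V = ℤxR.trans (mk≋ (equalᵇ-sound (U k) (subSq (V k)) U≡V)) (coeffs-subSq (V k))
  Us≋σVs-triple (suc m) with Us≋σVs-triple m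
  ... | U₁≋ , U₂≋ , U₃≋ = U₂≋ , U₃≋ , Us≋σVs-step m U₁≋ U₂≋ U₃≋

  Us≋σVs : ∀ m → Us (suc m) ≋ σ (Vs (suc m))
  Us≋σVs m = proj₁ (Us≋σVs-triple m)

  -- ∂(PQ − RS) and the first few H₂ and ∂H₂ in terms of X = x, N = j, H = H₂(j − 1), A = H₂(j), as in UShapes.
  module ∂UShapes {T : Set} (plus times : T → T → T) (neg : T → T) (c₁ c₂ c₃ : T) where
    infixl 6 _+′_
    infixl 7 _*′_
    _+′_ _*′_ : T → T → T
    _+′_ = plus
    _*′_ = times
    ∂-diff : T → T → T → T → T → T → T → T → T
    ∂-diff P Q R S ∂P ∂Q ∂R ∂S = (∂P *′ Q +′ P *′ ∂Q) +′ neg (∂R *′ S +′ R *′ ∂S)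
    h₁ h₂ h₃ u₁ ∂u₁ ∂u₂ rhs : T → T → T → T → T
    h₁ X N H A = X *′ A +′ N *′ H
    h₂ X N H A = X *′ h₁ X N H A +′ (c₁ +′ N) *′ A
    h₃ X N H A = X *′ h₂ X N H A +′ (c₂ +′ N) *′ h₁ X N H A
    u₁ X N H A = A *′ h₂ X N H A +′ neg (h₁ X N H A *′ h₁ X N H A)
    ∂u₁ X N H A = ∂-diff A (h₂ X N H A) (h₁ X N H A) (h₁ X N H A)
                         (N *′ H) ((c₂ +′ N) *′ h₁ X N H A) ((c₁ +′ N) *′ A) ((c₁ +′ N) *′ A)
    ∂u₂ X N H A = ∂-diff (h₁ X N H A) (h₃ X N H A) (h₂ X N H A) (h₂ X N H A)
                         ((c₁ +′ N) *′ A) ((c₃ +′ N) *′ h₂ X N H A) ((c₂ +′ N) *′ h₁ X N H A) ((c₂ +′ N) *′ h₁ X N H A)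
    rhs X N H A = (c₁ +′ N) *′ (c₂ *′ (X *′ u₁ X N H A) +′ ∂u₁ X N H A)

  module ∂UShapesℤx = ∂UShapes _⊕_ _⊛_ ⊝_ (ιℤx 1) (ιℤx 2) (ιℤx 3)
  module ∂UShapesSyntax = ∂UShapes {ℤxSolver.Polynomial 4} _:+_ _:*_ :-_ (con (+ 1)) (con (+ 2)) (con (+ 3))

  ∂U-identity : ∀ X N H A → ∂UShapesℤx.∂u₂ X N H A ≋ ∂UShapesℤx.rhs X N H A
  ∂U-identity = solve 4 (λ X N H A → ∂UShapesSyntax.∂u₂ X N H A := ∂UShapesSyntax.rhs X N H A) ℤxR.refl

  ∂-difference : ∀ P Q R S → ∂ (P ⊛ Q ⊕ ⊝ (R ⊛ S)) ≋ ∂UShapesℤx.∂-diff P Q R S (∂ P) (∂ Q) (∂ R) (∂ S)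
  ∂-difference P Q R S = ℤxR.trans (ℤx.∂-⊕ _ _) (ℤxR.+-cong (ℤx.∂-⊛ P Q) (ℤxR.trans (ℤx.∂-⊝ _) (ℤxR.-‿cong (ℤx.∂-⊛ R S))))

  ∂-difference-cong : ∀ {P P′ Q Q′ R R′ S S′ ∂P ∂P′ ∂Q ∂Q′ ∂R ∂R′ ∂S ∂S′} →
                      P ≋ P′ → Q ≋ Q′ → R ≋ R′ → S ≋ S′ → ∂P ≋ ∂P′ → ∂Q ≋ ∂Q′ → ∂R ≋ ∂R′ → ∂S ≋ ∂S′ →
                      ∂UShapesℤx.∂-diff P Q R S ∂P ∂Q ∂R ∂S ≋ ∂UShapesℤx.∂-diff P′ Q′ R′ S′ ∂P′ ∂Q′ ∂R′ ∂S′
  ∂-difference-cong P≋ Q≋ R≋ S≋ ∂P≋ ∂Q≋ ∂R≋ ∂S≋ =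
    ℤxR.+-cong (ℤxR.+-cong (ℤxR.*-cong ∂P≋ Q≋) (ℤxR.*-cong P≋ ∂Q≋)) (ℤxR.-‿cong (ℤxR.+-cong (ℤxR.*-cong ∂R≋ S≋) (ℤxR.*-cong R≋ ∂S≋)))

  -- from ∂H₂(n) = n H₂(n − 1)
  ∂Us-rec : ∀ j → ∂ (Us (2 ℕ.+ j)) ≋ ιℤx (1 ℕ.+ j) ⊛ (ιℤx 2 ⊛ (τ ⊛ Us (1 ℕ.+ j)) ⊕ ∂ (Us (1 ℕ.+ j)))
  ∂Us-rec j = begin
    ∂ (Us (2 ℕ.+ j))
      ≈⟨ ℤxR.trans (ℤx.∂-cong (Us-def (2 ℕ.+ j))) (ℤxR.trans (∂-difference _ _ _ _) (∂-difference-cong h₁ h₃ h₂ h₂ ∂h₁ ∂h₃ ∂h₂ ∂h₂)) ⟩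
    ∂UShapesℤx.∂u₂ X N H A
      ≈⟨ ∂U-identity X N H A ⟩
    ∂UShapesℤx.rhs X N H A
      ≈⟨ ℤxR.*-cong (ℤxR.sym (ℤx.ιₛ-+ 1 j)) (ℤxR.+-cong (ℤxR.*-congˡ (ℤxR.*-congˡ (ℤxR.sym u₁))) (ℤxR.sym ∂u₁)) ⟩
    ιℤx (1 ℕ.+ j) ⊛ (ιℤx 2 ⊛ (τ ⊛ Us (1 ℕ.+ j)) ⊕ ∂ (Us (1 ℕ.+ j))) ∎
    where
    X = τ
    N = ιℤx j
    H = Hs (j ∸ 1)
    A = Hs j
    h₁ : Hs (1 ℕ.+ j) ≋ ∂UShapesℤx.h₁ X N H A
    h₁ = Hs-rec′ j
    h₂ : Hs (2 ℕ.+ j) ≋ ∂UShapesℤx.h₂ X N H A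
    h₂ = ℤxR.trans (Hs-rec j) (ℤxR.+-cong (ℤxR.*-congˡ h₁) (ℤxR.*-congʳ (ℤx.ιₛ-+ 1 j)))
    h₃ : Hs (3 ℕ.+ j) ≋ ∂UShapesℤx.h₃ X N H A
    h₃ = ℤxR.trans (Hs-rec (1 ℕ.+ j)) (ℤxR.+-cong (ℤxR.*-congˡ h₂) (ℤxR.*-cong (ℤx.ιₛ-+ 2 j) h₁))
    ∂h₁ : ∂ (Hs (1 ℕ.+ j)) ≋ (ιℤx 1 ⊕ N) ⊛ A
    ∂h₁ = ℤxR.trans (∂Hs (1 ℕ.+ j)) (ℤxR.*-congʳ (ℤx.ιₛ-+ 1 j))
    ∂h₂ : ∂ (Hs (2 ℕ.+ j)) ≋ (ιℤx 2 ⊕ N) ⊛ ∂UShapesℤx.h₁ X N H A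
    ∂h₂ = ℤxR.trans (∂Hs (2 ℕ.+ j)) (ℤxR.*-cong (ℤx.ιₛ-+ 2 j) h₁)
    ∂h₃ : ∂ (Hs (3 ℕ.+ j)) ≋ (ιℤx 3 ⊕ N) ⊛ ∂UShapesℤx.h₂ X N H A
    ∂h₃ = ℤxR.trans (∂Hs (3 ℕ.+ j)) (ℤxR.*-cong (ℤx.ιₛ-+ 3 j) h₂)
    u₁ : Us (1 ℕ.+ j) ≋ ∂UShapesℤx.u₁ X N H A
    u₁ = ℤxR.trans (Us-def (1 ℕ.+ j)) (ℤxR.+-cong (ℤxR.*-congˡ h₂) (ℤxR.-‿cong (ℤxR.*-cong h₁ h₁)))
    ∂u₁ : ∂ (Us (1 ℕ.+ j)) ≋ ∂UShapesℤx.∂u₁ X N H A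
    ∂u₁ = ℤxR.trans (ℤx.∂-cong (Us-def (1 ℕ.+ j)))
                    (ℤxR.trans (∂-difference _ _ _ _) (∂-difference-cong ℤxR.refl h₂ h₁ h₁ (∂Hs j) ∂h₂ ∂h₁ ∂h₁))


module VCoefficients where

  open import Data.Integer using (_-_)
  open import Data.Integer.Tactic.RingSolver using (solve-∀)
  open HermiteDeterminant
  open ℤx using (at; un; _⊕_; _⊛_; τ; ∂)
  open P using (refl; cong; cong₂; sym; trans)
  open P.≡-Reasoning

  a : ℕ → ℕ → ℤ
  a i n = coeff (V n) i

  cong₃ : ∀ {A B C D : Set} (f : A → B → C → D) {x y u v s t} → x ≡ y → u ≡ v → s ≡ t → f x u s ≡ f y v t
  cong₃ f refl refl refl = refl

  σᶠ-even : ∀ f i → σᶠ f (i ℕ.+ i) ≡ f i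
  σᶠ-even f zero = refl
  σᶠ-even f (suc i) rewrite ℕP.+-suc i i = σᶠ-even (λ k → f (suc k)) i

  at-ιℤx⊛ : ∀ k f n → at (ιℤx k ⊛ f) n ≡ + k ℤ.* at f n
  at-ιℤx⊛ k f n = trans (ℤx.at-ιₛ⊛ k f n) (cong (ℤ._* at f n) (ιℤ≡ k))

  at-τ⊛σ-odd : ∀ f i → at (τ ⊛ σ f) (suc (i ℕ.+ i)) ≡ at f i
  at-τ⊛σ-odd f i = trans (ℤx.at-τ⊛-suc (σ f) (i ℕ.+ i)) (σᶠ-even (at f) i)

  at-∂σ-odd : ∀ f i → at (∂ (σ f)) (suc (i ℕ.+ i)) ≡ + 2 ℤ.* (+ suc i ℤ.* at f (suc i))
  at-∂σ-odd f i = begin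
    ℤx.ι (suc (suc (i ℕ.+ i))) ℤ.* σᶠ (λ k → at f (suc k)) (i ℕ.+ i)
      ≡⟨ cong₂ ℤ._*_ (ιℤ≡ (suc (suc (i ℕ.+ i)))) (σᶠ-even _ i) ⟩
    + suc (suc (i ℕ.+ i)) ℤ.* at f (suc i)
      ≡⟨ cong (λ k → + k ℤ.* at f (suc i)) (ℕP.+-suc (suc i) i) ⟨
    + (suc i ℕ.+ suc i) ℤ.* at f (suc i)
      ≡⟨ cong (ℤ._* at f (suc i)) (ℤP.pos-+ (suc i) (suc i)) ⟩
    (+ suc i ℤ.+ + suc i) ℤ.* at f (suc i)
      ≡⟨ double (+ suc i) (at f (suc i)) ⟩
    + 2 ℤ.* (+ suc i ℤ.* at f (suc i)) ∎
    where
    double : ∀ k x → (k ℤ.+ k) ℤ.* x ≡ + 2 ℤ.* (k ℤ.* x)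
    double = solve-∀

  -- The coefficient of x^(2i+1) in ∂U(j+2) = (j+1)(2x U(j+1) + ∂U(j+1)), where U = V(x²):
  -- the relation V′(j+2) = (j+1)(V(j+1) + V′(j+1)) read off coefficientwise.
  derivative-rec : ∀ j i → + suc i ℤ.* a (suc i) (suc (suc j))
                         ≡ + suc j ℤ.* (a i (suc j) ℤ.+ + suc i ℤ.* a (suc i) (suc j))
  derivative-rec j i = ℤP.*-cancelˡ-≡ (+ 2) _ _ (begin
    + 2 ℤ.* (+ suc i ℤ.* a (suc i) (suc (suc j)))
      ≡⟨ at-∂σ-odd (Vs (suc (suc j))) i ⟨
    at (∂ (σ (Vs (suc (suc j))))) n
      ≡⟨ un (ℤx.∂-cong (ℤxR.sym (Us≋σVs (suc j)))) n ⟩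
    at (∂ (Us (suc (suc j)))) n
      ≡⟨ un (∂Us-rec j) n ⟩
    at (ιℤx (suc j) ⊛ (ιℤx 2 ⊛ (τ ⊛ Us (suc j)) ⊕ ∂ (Us (suc j)))) n
      ≡⟨ at-ιℤx⊛ (suc j) (ιℤx 2 ⊛ (τ ⊛ Us (suc j)) ⊕ ∂ (Us (suc j))) n ⟩
    + suc j ℤ.* (at (ιℤx 2 ⊛ (τ ⊛ Us (suc j))) n ℤ.+ at (∂ (Us (suc j))) n)
      ≡⟨ cong (λ u → + suc j ℤ.* (u ℤ.+ at (∂ (Us (suc j))) n)) (at-ιℤx⊛ 2 (τ ⊛ Us (suc j)) n) ⟩
    + suc j ℤ.* (+ 2 ℤ.* at (τ ⊛ Us (suc j)) n ℤ.+ at (∂ (Us (suc j))) n)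
      ≡⟨ cong₂ (λ u v → + suc j ℤ.* (+ 2 ℤ.* u ℤ.+ v))
               (trans (un (ℤxR.*-congˡ {τ} (Us≋σVs j)) n) (at-τ⊛σ-odd (Vs (suc j)) i))
               (trans (un (ℤx.∂-cong (Us≋σVs j)) n) (at-∂σ-odd (Vs (suc j)) i)) ⟩
    + suc j ℤ.* (+ 2 ℤ.* a i (suc j) ℤ.+ + 2 ℤ.* (+ suc i ℤ.* a (suc i) (suc j)))
      ≡⟨ factor-2 (+ suc j) (a i (suc j)) (+ suc i ℤ.* a (suc i) (suc j)) ⟩
    + 2 ℤ.* (+ suc j ℤ.* (a i (suc j) ℤ.+ + suc i ℤ.* a (suc i) (suc j))) ∎)
    where
    n = suc (i ℕ.+ i)
    factor-2 : ∀ c x y → c ℤ.* (+ 2 ℤ.* x ℤ.+ + 2 ℤ.* y) ≡ + 2 ℤ.* (c ℤ.* (x ℤ.+ y))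
    factor-2 = solve-∀

  a-above-degree : ∀ j i → j ℕ.< i → a i (suc j) ≡ + 0
  a-above-degree zero (suc i) _ = refl
  a-above-degree (suc j) (suc i) (s≤s j<i) = ℤP.*-cancelˡ-≡ (+ suc i) _ _ (begin
    + suc i ℤ.* a (suc i) (suc (suc j))
      ≡⟨ derivative-rec j i ⟩
    + suc j ℤ.* (a i (suc j) ℤ.+ + suc i ℤ.* a (suc i) (suc j))
      ≡⟨ cong₂ (λ u v → + suc j ℤ.* (u ℤ.+ + suc i ℤ.* v))
               (a-above-degree j i j<i) (a-above-degree j (suc i) (ℕP.m<n⇒m<1+n j<i)) ⟩
    + suc j ℤ.* (+ 0 ℤ.+ + suc i ℤ.* + 0)
      ≡⟨ vanish (+ suc j) (+ suc i) ⟩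
    + suc i ℤ.* + 0 ∎)
    where
    vanish : ∀ c d → c ℤ.* (+ 0 ℤ.+ d ℤ.* + 0) ≡ d ℤ.* + 0
    vanish = solve-∀

  a-leading : ∀ j → a j (suc j) ≡ + 1
  a-leading zero = refl
  a-leading (suc j) = ℤP.*-cancelˡ-≡ (+ suc j) _ _ (begin
    + suc j ℤ.* a (suc j) (suc (suc j))
      ≡⟨ derivative-rec j j ⟩
    + suc j ℤ.* (a j (suc j) ℤ.+ + suc j ℤ.* a (suc j) (suc j))
      ≡⟨ cong₂ (λ u v → + suc j ℤ.* (u ℤ.+ + suc j ℤ.* v)) (a-leading j) (a-above-degree j (suc j) ℕP.≤-refl) ⟩
    + suc j ℤ.* (+ 1 ℤ.+ + suc j ℤ.* + 0)
      ≡⟨ unit (+ suc j) ⟩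
    + suc j ℤ.* + 1 ∎)
    where
    unit : ∀ c → c ℤ.* (+ 1 ℤ.+ c ℤ.* + 0) ≡ c ℤ.* + 1
    unit = solve-∀

  -- the recurrence (2) at x = 0, with n = m + 4
  a₀-step : ℤ → ℤ → ℤ → ℤ → ℤ
  a₀-step m a₃ a₂ a₁ = (+ 1 ℤ.+ m) ℤ.* a₃ ℤ.+ (+ 2 ℤ.+ m) ℤ.* ((+ 4 ℤ.+ m) ℤ.* a₂)
                       - ((+ 1 ℤ.+ m) ℤ.* ((+ 2 ℤ.+ m) ℤ.* (+ 2 ℤ.+ m))) ℤ.* a₁

  a₀-rec : ∀ m → a 0 (4 ℕ.+ m) ≡ a₀-step (+ m) (a 0 (3 ℕ.+ m)) (a 0 (2 ℕ.+ m)) (a 0 (1 ℕ.+ m))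
  a₀-rec m = trans (un (Vs-rec m) 0) (cong₃ (λ x y z → (+ 0 ℤ.+ x) ℤ.* a 0 (3 ℕ.+ m) ℤ.+ y ℤ.* ((+ 0 ℤ.+ z) ℤ.* a 0 (2 ℕ.+ m))
                                                       - (x ℤ.* (y ℤ.* y)) ℤ.* a 0 (1 ℕ.+ m))
                                            (at-ιℤx-0 (1 ℕ.+ m)) (at-ιℤx-0 (2 ℕ.+ m)) (at-ιℤx-0 (4 ℕ.+ m)))
    where
    at-ιℤx-0 : ∀ k → at (ιℤx k) 0 ≡ + k
    at-ιℤx-0 k = un (ιℤx≋κ k) 0

  odd : ℕ → ℕ
  odd zero = 1
  odd (suc k) = suc (suc (odd k))

  oddFactorial : ℕ → ℕ
  oddFactorial zero = 1
  oddFactorial (suc k) = odd k ℕ.* oddFactorial k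

  d : ℕ → ℤ
  d k = + oddFactorial k

  d-suc : ∀ k → d (suc k) ≡ + odd k ℤ.* d k
  d-suc k = ℤP.pos-* (odd k) (oddFactorial k)

  ConstantTerms : ℕ → Set
  ConstantTerms k = (a 0 (odd k) ≡ d (suc k) ℤ.* d k) × (a 0 (suc (odd k)) ≡ ℤ.- (d (suc k) ℤ.* d (suc k)))

  constantTerms-step : ∀ k → ConstantTerms k → ConstantTerms (suc k) → ConstantTerms (suc (suc k))
  constantTerms-step k (_ , a₀-even-k) (a₀-odd-k+1 , a₀-even-k+1) = a₀-odd-k+2 , a₀-even-k+2
    where
    o = + odd k
    d₁ = d (suc k)
    d₂ = (+ 2 ℤ.+ o) ℤ.* d₁
    d₃ = (+ 4 ℤ.+ o) ℤ.* d₂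

    d₂≡ : d (suc (suc k)) ≡ d₂
    d₂≡ = d-suc (suc k)

    d₃≡ : d (suc (suc (suc k))) ≡ d₃
    d₃≡ = trans (d-suc (suc (suc k))) (cong ((+ 4 ℤ.+ o) ℤ.*_) d₂≡)

    a₀-odd-k+2 : a 0 (odd (suc (suc k))) ≡ d (suc (suc (suc k))) ℤ.* d (suc (suc k))
    a₀-odd-k+2 = begin
      a 0 (odd (suc (suc k)))
        ≡⟨ a₀-rec (odd k) ⟩
      a₀-step o (a 0 (suc (odd (suc k)))) (a 0 (odd (suc k))) (a 0 (suc (odd k)))
        ≡⟨ cong₃ (a₀-step o) a₀-even-k+1 a₀-odd-k+1 a₀-even-k ⟩
      a₀-step o (ℤ.- (d (suc (suc k)) ℤ.* d (suc (suc k)))) (d (suc (suc k)) ℤ.* d₁) (ℤ.- (d₁ ℤ.* d₁))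
        ≡⟨ cong (λ e → a₀-step o (ℤ.- (e ℤ.* e)) (e ℤ.* d₁) (ℤ.- (d₁ ℤ.* d₁))) d₂≡ ⟩
      a₀-step o (ℤ.- (d₂ ℤ.* d₂)) (d₂ ℤ.* d₁) (ℤ.- (d₁ ℤ.* d₁))
        ≡⟨ identity o d₁ ⟩
      d₃ ℤ.* d₂
        ≡⟨ cong₂ ℤ._*_ d₃≡ d₂≡ ⟨
      d (suc (suc (suc k))) ℤ.* d (suc (suc k)) ∎
      where
      identity : ∀ o d₁ → let d₂ = (+ 2 ℤ.+ o) ℤ.* d₁ in
                 (+ 1 ℤ.+ o) ℤ.* ℤ.- (d₂ ℤ.* d₂) ℤ.+ (+ 2 ℤ.+ o) ℤ.* ((+ 4 ℤ.+ o) ℤ.* (d₂ ℤ.* d₁))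
                 - ((+ 1 ℤ.+ o) ℤ.* ((+ 2 ℤ.+ o) ℤ.* (+ 2 ℤ.+ o))) ℤ.* ℤ.- (d₁ ℤ.* d₁)
                 ≡ (+ 4 ℤ.+ o) ℤ.* d₂ ℤ.* d₂
      identity = solve-∀

    a₀-even-k+2 : a 0 (suc (odd (suc (suc k)))) ≡ ℤ.- (d (suc (suc (suc k))) ℤ.* d (suc (suc (suc k))))
    a₀-even-k+2 = begin
      a 0 (suc (odd (suc (suc k))))
        ≡⟨ a₀-rec (suc (odd k)) ⟩
      a₀-step (+ 1 ℤ.+ o) (a 0 (odd (suc (suc k)))) (a 0 (suc (odd (suc k)))) (a 0 (odd (suc k)))
        ≡⟨ cong₃ (a₀-step (+ 1 ℤ.+ o)) a₀-odd-k+2 a₀-even-k+1 a₀-odd-k+1 ⟩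
      a₀-step (+ 1 ℤ.+ o) (d (suc (suc (suc k))) ℤ.* d (suc (suc k)))
              (ℤ.- (d (suc (suc k)) ℤ.* d (suc (suc k)))) (d (suc (suc k)) ℤ.* d₁)
        ≡⟨ cong₂ (λ e f → a₀-step (+ 1 ℤ.+ o) (f ℤ.* e) (ℤ.- (e ℤ.* e)) (e ℤ.* d₁)) d₂≡ d₃≡ ⟩
      a₀-step (+ 1 ℤ.+ o) (d₃ ℤ.* d₂) (ℤ.- (d₂ ℤ.* d₂)) (d₂ ℤ.* d₁)
        ≡⟨ identity o d₁ ⟩
      ℤ.- (d₃ ℤ.* d₃)
        ≡⟨ cong (λ e → ℤ.- (e ℤ.* e)) d₃≡ ⟨
      ℤ.- (d (suc (suc (suc k))) ℤ.* d (suc (suc (suc k)))) ∎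
      where
      identity : ∀ o d₁ → let d₂ = (+ 2 ℤ.+ o) ℤ.* d₁ ; d₃ = (+ 4 ℤ.+ o) ℤ.* d₂ in
                 (+ 2 ℤ.+ o) ℤ.* (d₃ ℤ.* d₂) ℤ.+ (+ 3 ℤ.+ o) ℤ.* ((+ 5 ℤ.+ o) ℤ.* ℤ.- (d₂ ℤ.* d₂))
                 - ((+ 2 ℤ.+ o) ℤ.* ((+ 3 ℤ.+ o) ℤ.* (+ 3 ℤ.+ o))) ℤ.* (d₂ ℤ.* d₁)
                 ≡ ℤ.- (d₃ ℤ.* d₃)
      identity = solve-∀

  constantTerms : ∀ k → ConstantTerms k × ConstantTerms (suc k)
  constantTerms zero = (refl , refl) , (refl , refl)
  constantTerms (suc k) with constantTerms k
  ... | terms-k , terms-k+1 = terms-k+1 , constantTerms-step k terms-k terms-k+1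

  a₀-odd : ∀ k → a 0 (odd k) ≡ d (suc k) ℤ.* d k
  a₀-odd k = proj₁ (proj₁ (constantTerms k))

  a₀-even : ∀ k → a 0 (suc (odd k)) ≡ ℤ.- (d (suc k) ℤ.* d (suc k))
  a₀-even k = proj₂ (proj₁ (constantTerms k))

  -- derivative-rec at i = 0 expresses a(1, n+1) through a(0, n) and a(1, n)
  LinearTerms : ℕ → Set
  LinearTerms k = (a 1 (odd k) ≡ + 0) × (a 1 (suc (odd k)) ≡ d (suc k) ℤ.* d (suc k))

  linearTerms : ∀ k → LinearTerms k
  linearTerms zero = refl , refl
  linearTerms (suc k) = a₁-odd-k+1 , a₁-even-k+1
    where
    o = + odd k
    a₁-odd-k+1 : a 1 (odd (suc k)) ≡ + 0
    a₁-odd-k+1 = begin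
      a 1 (odd (suc k))
        ≡⟨ ℤP.*-identityˡ _ ⟨
      + 1 ℤ.* a 1 (odd (suc k))
        ≡⟨ derivative-rec (odd k) 0 ⟩
      (+ 1 ℤ.+ o) ℤ.* (a 0 (suc (odd k)) ℤ.+ + 1 ℤ.* a 1 (suc (odd k)))
        ≡⟨ cong₂ (λ u v → (+ 1 ℤ.+ o) ℤ.* (u ℤ.+ + 1 ℤ.* v)) (a₀-even k) (proj₂ (linearTerms k)) ⟩
      (+ 1 ℤ.+ o) ℤ.* (ℤ.- (d (suc k) ℤ.* d (suc k)) ℤ.+ + 1 ℤ.* (d (suc k) ℤ.* d (suc k)))
        ≡⟨ cancel o (d (suc k)) ⟩
      + 0 ∎
      where
      cancel : ∀ o e → (+ 1 ℤ.+ o) ℤ.* (ℤ.- (e ℤ.* e) ℤ.+ + 1 ℤ.* (e ℤ.* e)) ≡ + 0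
      cancel = solve-∀
    a₁-even-k+1 : a 1 (suc (odd (suc k))) ≡ d (suc (suc k)) ℤ.* d (suc (suc k))
    a₁-even-k+1 = begin
      a 1 (suc (odd (suc k)))
        ≡⟨ ℤP.*-identityˡ _ ⟨
      + 1 ℤ.* a 1 (suc (odd (suc k)))
        ≡⟨ derivative-rec (suc (odd k)) 0 ⟩
      (+ 2 ℤ.+ o) ℤ.* (a 0 (odd (suc k)) ℤ.+ + 1 ℤ.* a 1 (odd (suc k)))
        ≡⟨ cong₂ (λ u v → (+ 2 ℤ.+ o) ℤ.* (u ℤ.+ + 1 ℤ.* v)) (a₀-odd (suc k)) a₁-odd-k+1 ⟩
      (+ 2 ℤ.+ o) ℤ.* (d (suc (suc k)) ℤ.* d (suc k) ℤ.+ + 1 ℤ.* + 0)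
        ≡⟨ cong (λ e → (+ 2 ℤ.+ o) ℤ.* (e ℤ.* d (suc k) ℤ.+ + 1 ℤ.* + 0)) (d-suc (suc k)) ⟩
      (+ 2 ℤ.+ o) ℤ.* ((+ 2 ℤ.+ o) ℤ.* d (suc k) ℤ.* d (suc k) ℤ.+ + 1 ℤ.* + 0)
        ≡⟨ square o (d (suc k)) ⟩
      (+ 2 ℤ.+ o) ℤ.* d (suc k) ℤ.* ((+ 2 ℤ.+ o) ℤ.* d (suc k))
        ≡⟨ cong (λ e → e ℤ.* e) (d-suc (suc k)) ⟨
      d (suc (suc k)) ℤ.* d (suc (suc k)) ∎
      where
      square : ∀ o e → (+ 2 ℤ.+ o) ℤ.* ((+ 2 ℤ.+ o) ℤ.* e ℤ.* e ℤ.+ + 1 ℤ.* + 0) ≡ (+ 2 ℤ.+ o) ℤ.* e ℤ.* ((+ 2 ℤ.+ o) ℤ.* e)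
      square = solve-∀

  parity : ∀ n → (n ≡ 0) ⊎ (Σ ℕ λ k → n ≡ odd k) ⊎ (Σ ℕ λ k → n ≡ suc (odd k))
  parity zero = inj₁ refl
  parity (suc n) with parity n
  ... | inj₁ refl = inj₂ (inj₁ (0 , refl))
  ... | inj₂ (inj₁ (k , refl)) = inj₂ (inj₂ (k , refl))
  ... | inj₂ (inj₂ (k , refl)) = inj₂ (inj₁ (suc k , refl))

  a₁-nonneg : ∀ n → + 0 ℤ.≤ a 1 n
  a₁-nonneg n with parity n
  ... | inj₁ refl = ℤ.+≤+ z≤n
  ... | inj₂ (inj₁ (k , refl)) = ℤP.≤-reflexive (sym (proj₁ (linearTerms k)))
  ... | inj₂ (inj₂ (k , refl)) = P.subst (+ 0 ℤ.≤_) (sym (trans (proj₂ (linearTerms k)) (sym (ℤP.pos-* f f)))) (ℤ.+≤+ z≤n)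
    where f = oddFactorial (suc k)

  nonneg-cancel : ∀ i j {x w} → + suc i ℤ.* x ≡ + suc j ℤ.* w → + 0 ℤ.≤ w → + 0 ℤ.≤ x
  nonneg-cancel i j {x} {w} eq 0≤w = ℤP.*-cancelˡ-≤-pos (+ 0) x (+ suc i)
    (P.subst₂ ℤ._≤_ (sym (ℤP.*-zeroʳ (+ suc i))) (sym eq)
      (P.subst (ℤ._≤ + suc j ℤ.* w) (ℤP.*-zeroʳ (+ suc j)) (ℤP.*-monoˡ-≤-nonNeg (+ suc j) 0≤w)))

  pos-cancel : ∀ i j {x w} → + suc i ℤ.* x ≡ + suc j ℤ.* w → + 0 ℤ.< w → + 0 ℤ.< x
  pos-cancel i j {x} {w} eq 0<w = ℤP.*-cancelˡ-<-nonNeg (+ suc i)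
    (P.subst₂ ℤ._<_ (sym (ℤP.*-zeroʳ (+ suc i))) (sym eq)
      (P.subst (ℤ._< + suc j ℤ.* w) (ℤP.*-zeroʳ (+ suc j)) (ℤP.*-monoˡ-<-pos (+ suc j) 0<w)))

  a-nonneg : ∀ j i → 1 ℕ.≤ i → + 0 ℤ.≤ a i (suc j)
  a-nonneg j (suc zero) _ = a₁-nonneg (suc j)
  a-nonneg zero (suc (suc i)) _ = ℤ.+≤+ z≤n
  a-nonneg (suc j) (suc (suc i)) _ = nonneg-cancel (suc i) j (derivative-rec j (suc i))
    (ℤP.+-mono-≤ (a-nonneg j (suc i) (s≤s z≤n))
      (P.subst (ℤ._≤ + suc (suc i) ℤ.* a (suc (suc i)) (suc j)) (ℤP.*-zeroʳ (+ suc (suc i)))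
        (ℤP.*-monoˡ-≤-nonNeg (+ suc (suc i)) (a-nonneg j (suc (suc i)) (s≤s z≤n)))))

  -- By derivative-rec, a(i, j+1) > 0 follows from a(i−1, j) ≥ 0 and a(i, j) > 0, starting from the leading coefficient 1.
  a-pos : ∀ j i → 2 ℕ.≤ i → i ℕ.≤ j → + 0 ℤ.< a i (suc j)
  a-pos (suc j) (suc i) (s≤s 1≤i) (s≤s i≤j) with ℕP.m≤n⇒m<n∨m≡n i≤j
  ... | inj₂ refl = pos-cancel i j (derivative-rec j i)
        (ℤP.+-mono-<-≤ (P.subst (+ 0 ℤ.<_) (sym (a-leading j)) (ℤ.+<+ (s≤s z≤n)))
           (P.subst (ℤ._≤ + suc j ℤ.* a (suc j) (suc j)) (ℤP.*-zeroʳ (+ suc j))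
              (ℤP.*-monoˡ-≤-nonNeg (+ suc j) (a-nonneg j (suc j) (s≤s z≤n)))))
  ... | inj₁ i<j = pos-cancel i j (derivative-rec j i)
        (ℤP.+-mono-≤-< (a-nonneg j i 1≤i)
           (P.subst (ℤ._< + suc i ℤ.* a (suc i) (suc j)) (ℤP.*-zeroʳ (+ suc i))
              (ℤP.*-monoˡ-<-pos (+ suc i) (a-pos j (suc i) (s≤s 1≤i) i<j))))

  U≈ₚsubSqV : ∀ n → 1 ≤ n → U n ≈ₚ subSq (V n)
  U≈ₚsubSqV (suc m) _ i = trans (un (Us≋σVs m) i) (sym (un (coeffs-subSq (V (suc m))) i))

  V-hasDegree : ∀ n → 1 ≤ n → HasDegree (V n) (n ∸ 1)
  V-hasDegree (suc m) _ = leading≢0 , a-above-degree m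
    where
    leading≢0 : ¬ a m (suc m) ≡ + 0
    leading≢0 eq with trans (sym (a-leading m)) eq
    ... | ()

  V-rec : ∀ n → 4 ≤ n →
          V n ≈ₚ ((Xₚ +ₚ constₚ (+ n - + 3)) *ₚ V (n ∸ 1)
                  +ₚ (+ n - + 2) ·ₚ ((Xₚ +ₚ constₚ (+ n)) *ₚ V (n ∸ 2))
                  -ₚ ((+ n - + 3) ℤ.* ((+ n - + 2) ℤ.* (+ n - + 2))) ·ₚ V (n ∸ 3))
  V-rec (suc (suc (suc (suc m)))) (s≤s (s≤s (s≤s (s≤s _)))) i = refl

  V-coeff-pos : ∀ n i → 1 ≤ n → 2 ≤ i → i ≤ n ∸ 1 → + 0 ℤ.< a i n
  V-coeff-pos (suc j) i _ = a-pos j i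


module RationalArithmetic where

  open import Data.Integer.Tactic.RingSolver using (solve-∀)
  open P using (refl)

  toℚᵘ-/ : ∀ i c → ℚ.toℚᵘ (i / suc c) ℚᵘ.≃ ℚᵘ.mkℚᵘ i c
  toℚᵘ-/ i c = ℚP.toℚᵘ-fromℚᵘ (ℚᵘ.mkℚᵘ i c)

  /-cross : ∀ i j c d → i ℤ.* + suc d ≡ j ℤ.* + suc c → i / suc c ≡ j / suc d
  /-cross i j c d eq = ℚP.toℚᵘ-injective (ℚᵘP.≃-trans (toℚᵘ-/ i c) (ℚᵘP.≃-trans (ℚᵘ.*≡* eq) (ℚᵘP.≃-sym (toℚᵘ-/ j d))))

  /-* : ∀ i j c d → (i / suc c) ℚ.* (j / suc d) ≡ (i ℤ.* j) / (suc c ℕ.* suc d)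
  /-* i j c d = ℚP.toℚᵘ-injective (ℚᵘP.≃-trans (ℚP.toℚᵘ-homo-* (i / suc c) (j / suc d))
    (ℚᵘP.≃-trans (ℚᵘP.*-cong (toℚᵘ-/ i c) (toℚᵘ-/ j d)) (ℚᵘP.≃-sym (toℚᵘ-/ (i ℤ.* j) (d ℕ.+ c ℕ.* suc d)))))

  /-neg : ∀ i c → ℚ.- (i / suc c) ≡ (ℤ.- i) / suc c
  /-neg i c = ℚP.toℚᵘ-injective (ℚᵘP.≃-trans (ℚP.toℚᵘ-homo‿- (i / suc c))
    (ℚᵘP.≃-trans (ℚᵘP.-‿cong (toℚᵘ-/ i c)) (ℚᵘP.≃-sym (toℚᵘ-/ (ℤ.- i) c))))

  /-suc-pred : ∀ i d .{{_ : ℕ.NonZero d}} → i / d ≡ i / suc (ℕ.pred d)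
  /-suc-pred i d = ℚP./-cong {i} {d} {i} {suc (ℕ.pred d)} {{_}} {{_}} refl (P.sym (ℕP.suc-pred d))

  ℤ→ℚ-* : ∀ x y → ℤ→ℚ (x ℤ.* y) ≡ ℤ→ℚ x ℚ.* ℤ→ℚ y
  ℤ→ℚ-* x y = P.sym (/-* x y 0 0)

  ℤ→ℚ-neg : ∀ x → ℤ→ℚ (ℤ.- x) ≡ ℚ.- ℤ→ℚ x
  ℤ→ℚ-neg x = P.sym (/-neg x 0)

  ℤ→ℚ-+ : ∀ x y → ℤ→ℚ (x ℤ.+ y) ≡ ℤ→ℚ x ℚ.+ ℤ→ℚ y
  ℤ→ℚ-+ x y = ℚP.toℚᵘ-injective (ℚᵘP.≃-trans (toℚᵘ-/ (x ℤ.+ y) 0) (ℚᵘP.≃-trans (ℚᵘ.*≡* (sum-over-1 x y))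
               (ℚᵘP.≃-sym (ℚᵘP.≃-trans (ℚP.toℚᵘ-homo-+ (ℤ→ℚ x) (ℤ→ℚ y)) (ℚᵘP.+-cong (toℚᵘ-/ x 0) (toℚᵘ-/ y 0))))))
    where
    sum-over-1 : ∀ x y → (x ℤ.+ y) ℤ.* + 1 ≡ (x ℤ.* + 1 ℤ.+ y ℤ.* + 1) ℤ.* + 1
    sum-over-1 = solve-∀

  [N*i]/N≡i : ∀ i N .{{_ : ℕ.NonZero N}} → (+ N ℤ.* i) / N ≡ ℤ→ℚ i
  [N*i]/N≡i i N = P.trans (/-suc-pred (+ N ℤ.* i) N) (/-cross (+ N ℤ.* i) i (ℕ.pred N) 0 cross)
    where
    comm : ∀ n i → n ℤ.* i ℤ.* + 1 ≡ i ℤ.* n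
    comm = solve-∀
    cross : + N ℤ.* i ℤ.* + 1 ≡ i ℤ.* + suc (ℕ.pred N)
    cross = P.trans (comm (+ N) i) (P.cong (λ k → i ℤ.* + k) (P.sym (ℕP.suc-pred N)))

  1/n*n≡1 : ∀ k → (+ 1 / suc k) ℚ.* ℤ→ℚ (+ suc k) ≡ 1ℚ
  1/n*n≡1 k = P.trans (/-* (+ 1) (+ suc k) k 0) (/-cross (+ 1 ℤ.* + suc k) (+ 1) (k ℕ.* 1) 0
    (P.trans (ℤP.*-identityʳ _) (P.trans (ℤP.*-identityˡ _)
      (P.trans (P.cong (λ m → + suc m) (P.sym (ℕP.*-identityʳ k))) (P.sym (ℤP.*-identityˡ _))))))

  ℤ→ℚ-cancelˡ-suc : ∀ k y → ℤ→ℚ (+ suc k) ℚ.* y ≡ 0ℚ → y ≡ 0ℚ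
  ℤ→ℚ-cancelˡ-suc k y eq = begin
    y                                              ≡⟨ ℚP.*-identityˡ y ⟨
    1ℚ ℚ.* y                                       ≡⟨ P.cong (ℚ._* y) (1/n*n≡1 k) ⟨
    (+ 1 / suc k) ℚ.* ℤ→ℚ (+ suc k) ℚ.* y         ≡⟨ ℚP.*-assoc (+ 1 / suc k) (ℤ→ℚ (+ suc k)) y ⟩
    (+ 1 / suc k) ℚ.* (ℤ→ℚ (+ suc k) ℚ.* y)       ≡⟨ P.cong ((+ 1 / suc k) ℚ.*_) eq ⟩
    (+ 1 / suc k) ℚ.* 0ℚ                           ≡⟨ ℚP.*-zeroʳ (+ 1 / suc k) ⟩
    0ℚ                                             ∎
    where open P.≡-Reasoning


module LowCoefficients where

  open import Data.Nat.Tactic.RingSolver using (solve-∀)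
  open import Data.Rational.Solver using (module +-*-Solver)
  open P using (refl; cong; sym; trans)
  open P.≡-Reasoning
  open HermiteDeterminant using (V)
  open VCoefficients
  open RationalArithmetic

  odd≡ : ∀ n → odd n ≡ suc (2 ℕ.* n)
  odd≡ zero = refl
  odd≡ (suc n) = trans (cong (λ k → suc (suc k)) (odd≡ n)) (step n)
    where
    step : ∀ n → suc (suc (suc (2 ℕ.* n))) ≡ suc (2 ℕ.* suc n)
    step = solve-∀

  2[1+k]≡1+odd : ∀ k → 2 ℕ.* suc k ≡ suc (odd k)
  2[1+k]≡1+odd k = trans (2[1+k] k) (cong suc (sym (odd≡ k)))
    where
    2[1+k] : ∀ k → 2 ℕ.* suc k ≡ suc (suc (2 ℕ.* k))
    2[1+k] = solve-∀

  [2n]!≡ : ∀ n → (2 ℕ.* n) ! ≡ (2 ^ n ℕ.* n !) ℕ.* oddFactorial n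
  [2n]!≡ zero = refl
  [2n]!≡ (suc n) = begin
    (2 ℕ.* suc n) !
      ≡⟨ cong _! (2[1+n] n) ⟩
    (2 ℕ.+ 2 ℕ.* n) ℕ.* ((1 ℕ.+ 2 ℕ.* n) ℕ.* (2 ℕ.* n) !)
      ≡⟨ cong (λ k → (2 ℕ.+ 2 ℕ.* n) ℕ.* ((1 ℕ.+ 2 ℕ.* n) ℕ.* k)) ([2n]!≡ n) ⟩
    (2 ℕ.+ 2 ℕ.* n) ℕ.* ((1 ℕ.+ 2 ℕ.* n) ℕ.* (2 ^ n ℕ.* n ! ℕ.* oddFactorial n))
      ≡⟨ regroup (2 ^ n) (n !) (oddFactorial n) n ⟩
    2 ℕ.* 2 ^ n ℕ.* (n ! ℕ.+ n ℕ.* n !) ℕ.* ((1 ℕ.+ 2 ℕ.* n) ℕ.* oddFactorial n)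
      ≡⟨ cong (λ o → 2 ^ suc n ℕ.* suc n ! ℕ.* (o ℕ.* oddFactorial n)) (odd≡ n) ⟨
    2 ^ suc n ℕ.* suc n ! ℕ.* oddFactorial (suc n) ∎
    where
    2[1+n] : ∀ n → 2 ℕ.* suc n ≡ suc (suc (2 ℕ.* n))
    2[1+n] = solve-∀
    regroup : ∀ p f o n → (2 ℕ.+ 2 ℕ.* n) ℕ.* ((1 ℕ.+ 2 ℕ.* n) ℕ.* (p ℕ.* f ℕ.* o))
                          ≡ 2 ℕ.* p ℕ.* (f ℕ.+ n ℕ.* f) ℕ.* ((1 ℕ.+ 2 ℕ.* n) ℕ.* o)
    regroup = solve-∀

  [2n+1]!≡ : ∀ n → suc (2 ℕ.* n) ! ≡ (2 ^ n ℕ.* n !) ℕ.* oddFactorial (suc n)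
  [2n+1]!≡ n = begin
    suc (2 ℕ.* n) ℕ.* (2 ℕ.* n) !
      ≡⟨ cong (suc (2 ℕ.* n) ℕ.*_) ([2n]!≡ n) ⟩
    suc (2 ℕ.* n) ℕ.* (2 ^ n ℕ.* n ! ℕ.* oddFactorial n)
      ≡⟨ regroup (2 ^ n ℕ.* n !) (oddFactorial n) (suc (2 ℕ.* n)) ⟩
    2 ^ n ℕ.* n ! ℕ.* (suc (2 ℕ.* n) ℕ.* oddFactorial n)
      ≡⟨ cong (λ o → 2 ^ n ℕ.* n ! ℕ.* (o ℕ.* oddFactorial n)) (odd≡ n) ⟨
    2 ^ n ℕ.* n ! ℕ.* oddFactorial (suc n) ∎
    where
    regroup : ∀ N f o → o ℕ.* (N ℕ.* f) ≡ N ℕ.* (o ℕ.* f)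
    regroup = solve-∀

  2^n*n!≢0 : ∀ n → ℕ.NonZero (2 ^ n ℕ.* n !)
  2^n*n!≢0 n = ℕP.m*n≢0 (2 ^ n) (n !) {{ℕP.m^n≢0 2 n}} {{ℕP._!≢0 n}}

  factRatio-exact : ∀ m n f → m ! ≡ (2 ^ n ℕ.* n !) ℕ.* f → factRatio m n ≡ ℤ→ℚ (+ f)
  factRatio-exact m n f m!≡ = begin
    (+ (m !) / N) {{2^n*n!≢0 n}}           ≡⟨ cong (λ k → (+ k / N) {{2^n*n!≢0 n}}) m!≡ ⟩
    (+ (N ℕ.* f) / N) {{2^n*n!≢0 n}}       ≡⟨ cong (λ i → (i / N) {{2^n*n!≢0 n}}) (ℤP.pos-* N f) ⟩
    (+ N ℤ.* + f / N) {{2^n*n!≢0 n}}       ≡⟨ [N*i]/N≡i (+ f) N {{2^n*n!≢0 n}} ⟩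
    ℤ→ℚ (+ f)                              ∎
    where N = 2 ^ n ℕ.* n !

  a₀-even-closed : ∀ n → 1 ≤ n → ℤ→ℚ (coeff (V (2 ℕ.* n)) 0) ≡ ℚ.- (factRatio (2 ℕ.* n) n ℚ.* factRatio (2 ℕ.* n) n)
  a₀-even-closed (suc k) _ = begin
    ℤ→ℚ (a 0 (2 ℕ.* suc k))                    ≡⟨ cong (λ m → ℤ→ℚ (a 0 m)) (2[1+k]≡1+odd k) ⟩
    ℤ→ℚ (a 0 (suc (odd k)))                    ≡⟨ cong ℤ→ℚ (a₀-even k) ⟩
    ℤ→ℚ (ℤ.- (d (suc k) ℤ.* d (suc k)))        ≡⟨ trans (ℤ→ℚ-neg (d (suc k) ℤ.* d (suc k))) (cong ℚ.-_ (ℤ→ℚ-* (d (suc k)) (d (suc k)))) ⟩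
    ℚ.- (ℤ→ℚ (d (suc k)) ℚ.* ℤ→ℚ (d (suc k)))  ≡⟨ cong (λ q → ℚ.- (q ℚ.* q)) factRatio≡ ⟨
    ℚ.- (factRatio (2 ℕ.* suc k) (suc k) ℚ.* factRatio (2 ℕ.* suc k) (suc k)) ∎
    where
    factRatio≡ : factRatio (2 ℕ.* suc k) (suc k) ≡ ℤ→ℚ (d (suc k))
    factRatio≡ = factRatio-exact (2 ℕ.* suc k) (suc k) (oddFactorial (suc k)) ([2n]!≡ (suc k))

  a₀-odd-closed : ∀ n → 1 ≤ n → ℤ→ℚ (coeff (V (suc (2 ℕ.* n))) 0)
                                 ≡ (factRatio (suc (2 ℕ.* n)) n ℚ.* factRatio (suc (2 ℕ.* n)) n) /ℕ suc (2 ℕ.* n)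
  a₀-odd-closed n _ = begin
    ℤ→ℚ (a 0 (suc (2 ℕ.* n)))      ≡⟨ cong (λ m → ℤ→ℚ (a 0 m)) (odd≡ n) ⟨
    ℤ→ℚ (a 0 (odd n))              ≡⟨ cong ℤ→ℚ (a₀-odd n) ⟩
    ℤ→ℚ (d (suc n) ℤ.* d n)        ≡⟨ ℤ→ℚ-* (d (suc n)) (d n) ⟩
    x ℚ.* y                        ≡⟨ ℚP.*-identityʳ (x ℚ.* y) ⟨
    x ℚ.* y ℚ.* 1ℚ                 ≡⟨ cong (x ℚ.* y ℚ.*_) (1/n*n≡1 (2 ℕ.* n)) ⟨
    x ℚ.* y ℚ.* (r ℚ.* c)          ≡⟨ regroup x y r c ⟩
    x ℚ.* (c ℚ.* y) ℚ.* r          ≡⟨ cong (λ z → x ℚ.* z ℚ.* r) x≡cy ⟨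
    x ℚ.* x ℚ.* r                  ≡⟨ cong (λ z → z ℚ.* z ℚ.* r) factRatio≡ ⟨
    (factRatio (suc (2 ℕ.* n)) n ℚ.* factRatio (suc (2 ℕ.* n)) n) /ℕ suc (2 ℕ.* n) ∎
    where
    x = ℤ→ℚ (d (suc n))
    y = ℤ→ℚ (d n)
    c = ℤ→ℚ (+ suc (2 ℕ.* n))
    r = + 1 / suc (2 ℕ.* n)
    x≡cy : x ≡ c ℚ.* y
    x≡cy = trans (cong ℤ→ℚ (trans (d-suc n) (cong (λ o → + o ℤ.* d n) (odd≡ n)))) (ℤ→ℚ-* (+ suc (2 ℕ.* n)) (d n))
    factRatio≡ : factRatio (suc (2 ℕ.* n)) n ≡ x
    factRatio≡ = factRatio-exact (suc (2 ℕ.* n)) n (oddFactorial (suc n)) ([2n+1]!≡ n)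
    regroup : ∀ x y r c → x ℚ.* y ℚ.* (r ℚ.* c) ≡ x ℚ.* (c ℚ.* y) ℚ.* r
    regroup = +-*-Solver.solve 4 (λ x y r c → x :* y :* (r :* c) := x :* (c :* y) :* r) refl
      where open +-*-Solver

  a₁-even : ∀ n → 1 ≤ n → coeff (V (2 ℕ.* n)) 1 ≡ ℤ.- coeff (V (2 ℕ.* n)) 0
  a₁-even (suc k) _ rewrite 2[1+k]≡1+odd k = begin
    a 1 (suc (odd k))                         ≡⟨ proj₂ (linearTerms k) ⟩
    d (suc k) ℤ.* d (suc k)                   ≡⟨ ℤP.neg-involutive _ ⟨
    ℤ.- (ℤ.- (d (suc k) ℤ.* d (suc k)))       ≡⟨ cong ℤ.-_ (a₀-even k) ⟨
    ℤ.- a 0 (suc (odd k))                     ∎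

  a₁-odd : ∀ n → 1 ≤ n → coeff (V (suc (2 ℕ.* n))) 1 ≡ + 0
  a₁-odd n _ rewrite sym (odd≡ n) = proj₁ (linearTerms n)


module TwoVariableSeries where

  open P using (refl)
  open RationalArithmetic using (ℤ→ℚ-+)

  module ℚx = FormalPowerSeries ℚP.+-*-commutativeRing
  open ℚx public using () renaming
    ( Series to Seriesₓ; at to at₁; _≋_ to _≋₁_; mk≋ to mk≋₁; un to un₁; _⊕_ to _⊕₁_; _⊛_ to _⊛₁_; ⊝_ to ⊝₁_
    ; 𝟘 to 𝟘₁; 𝟙 to 𝟙₁; κ to κ₁; τ to τ₁; ∑ to ∑₁)
  module ℚxR = CommutativeRing ℚx.seriesRing
  module ℚxSolver = IntegerCoefficientSolver ℚx.seriesRing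

  -- series in t with coefficients in ℚ[[x]]; τ is t and τ₁ is x
  module ℚxt = FormalPowerSeries ℚx.seriesRing
  open ℚxt public using (Series; at; _≋_; mk≋; un; _⊕_; _⊛_; ⊝_; 𝟘; 𝟙; κ; τ; ∂; ∑; shift; τ⊛≋shift)
  module ℚxtR = CommutativeRing ℚxt.seriesRing
  module ℚxtSolver = IntegerCoefficientSolver ℚxt.seriesRing

  ιℚ : ℕ → ℚ
  ιℚ = ℚx.ι

  ιℚ≡ : ∀ k → ιℚ k ≡ ℤ→ℚ (+ k)
  ιℚ≡ zero = refl
  ιℚ≡ (suc k) = P.trans (P.cong (1ℚ ℚ.+_) (ιℚ≡ k)) (P.sym (ℤ→ℚ-+ (+ 1) (+ k)))

  ι₁ : ℕ → Seriesₓ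
  ι₁ = ℚx.ιₛ

  ι₂ : ℕ → Series
  ι₂ = ℚxt.ιₛ

  ι₁1≋𝟙 : ι₁ 1 ≋₁ 𝟙₁
  ι₁1≋𝟙 = ℚxR.+-identityʳ 𝟙₁

  ι₂1≋𝟙 : ι₂ 1 ≋ 𝟙
  ι₂1≋𝟙 = ℚxtR.+-identityʳ 𝟙

  X : Series
  X = κ τ₁

  toSeriesₓ : (ℕ → ℚ) → Seriesₓ
  at₁ (toSeriesₓ g) i = g i

  embed : Ser → Series
  at (embed f) n = toSeriesₓ (f n)

  ∑₁≡sumTo : ∀ n f → ∑₁ n f ≡ sumTo n f
  ∑₁≡sumTo zero f = refl
  ∑₁≡sumTo (suc n) f = P.cong (ℚ._+ f (suc n)) (∑₁≡sumTo n f)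

  at-∑ : ∀ n (F : ℕ → Seriesₓ) i → at₁ (∑ n F) i ≡ sumTo n (λ a → at₁ (F a) i)
  at-∑ zero F i = refl
  at-∑ (suc n) F i = P.cong (ℚ._+ at₁ (F (suc n)) i) (at-∑ n F i)

  embed-+ₛ : ∀ f g → embed (f +ₛ g) ≋ embed f ⊕ embed g
  embed-+ₛ f g = mk≋ λ n → mk≋₁ λ i → refl

  embed--ₛ : ∀ f g → embed (f -ₛ g) ≋ embed f ⊕ ⊝ embed g
  embed--ₛ f g = mk≋ λ n → mk≋₁ λ i → refl

  sumTo-cong : ∀ n {f g : ℕ → ℚ} → (∀ a → f a ≡ g a) → sumTo n f ≡ sumTo n g
  sumTo-cong zero e = e 0
  sumTo-cong (suc n) e = P.cong₂ ℚ._+_ (sumTo-cong n e) (e (suc n))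

  embed-*ₛ : ∀ f g → embed (f *ₛ g) ≋ embed f ⊛ embed g
  embed-*ₛ f g = mk≋ λ n → mk≋₁ λ i → P.sym (P.trans (at-∑ n _ i) (sumTo-cong n (λ a → ∑₁≡sumTo i _)))

  embed-oneₛ : embed oneₛ ≋ 𝟙
  embed-oneₛ = mk≋ λ { zero → mk≋₁ λ { zero → refl ; (suc i) → refl } ; (suc n) → mk≋₁ λ i → refl }

  embed-tₛ : embed tₛ ≋ τ
  embed-tₛ = mk≋ λ { zero → mk≋₁ λ i → refl
                ; (suc zero) → mk≋₁ λ { zero → refl ; (suc i) → refl }
                ; (suc (suc n)) → mk≋₁ λ i → refl }

  embed-xₛ : embed xₛ ≋ X
  embed-xₛ = mk≋ λ { zero → mk≋₁ λ { zero → refl ; (suc zero) → refl ; (suc (suc i)) → refl }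
                ; (suc n) → mk≋₁ λ i → refl }

  pow : Series → ℕ → Series
  pow f zero = 𝟙
  pow f (suc k) = f ⊛ pow f k

  embed-cong : ∀ {f g} → f ≈ₛ g → embed f ≋ embed g
  embed-cong e = mk≋ λ n → mk≋₁ λ i → e n i

  embed-^ₛ : ∀ q k → embed (q ^ₛ k) ≋ pow (embed q) k
  embed-^ₛ q zero = embed-oneₛ
  embed-^ₛ q (suc k) = ℚxtR.trans (embed-*ₛ q (q ^ₛ k)) (ℚxtR.*-congˡ (embed-^ₛ q k))


module FormalODE where

  open P using (refl)
  open RationalArithmetic
  open TwoVariableSeries

  ι₁-cancel : ∀ k g → ι₁ (suc k) ⊛₁ g ≋₁ 𝟘₁ → g ≋₁ 𝟘₁
  ι₁-cancel k g e = mk≋₁ λ i → ℤ→ℚ-cancelˡ-suc k (at₁ g i)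
    (P.trans (P.cong (λ z → z ℚ.* at₁ g i) (P.sym (ιℚ≡ (suc k)))) (P.trans (P.sym (ℚx.at-ιₛ⊛ (suc k) g i)) (un₁ e i)))

  at-⊛-lowZeros : ∀ g f n → (∀ k → k ℕ.< n → at f k ≋₁ 𝟘₁) → at (g ⊛ f) n ≋₁ at g 0 ⊛₁ at f n
  at-⊛-lowZeros g f zero h = ℚxR.refl
  at-⊛-lowZeros g f (suc n) h = ℚxt.∑-head (suc n) _ (λ k → ℚxR.trans (ℚxR.*-congˡ {at g (suc k)} (h (n ∸ k) (s≤s (ℕP.m∸n≤m n k)))) (ℚxR.zeroʳ _))

  -- c Z′ = r Z with c(0) = 1 and Z(0) = 0 forces Z = 0: the coefficient of tⁿ determines (n + 1) Z(n + 1)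
  -- from Z(0), …, Z(n).
  ode-unique : ∀ c r Z → at c 0 ≋₁ 𝟙₁ → c ⊛ ∂ Z ≋ r ⊛ Z → at Z 0 ≋₁ 𝟘₁ → Z ≋ 𝟘
  ode-unique c r Z c₀≋1 ode Z₀≋0 = mk≋ λ n → Z≋0-below n n ℕP.≤-refl
    where
    Z≋0-below : ∀ n k → k ℕ.≤ n → at Z k ≋₁ 𝟘₁
    Z≋0-below zero zero _ = Z₀≋0
    Z≋0-below (suc n) k k≤ with ℕP.m≤n⇒m<n∨m≡n k≤
    ... | inj₁ (s≤s k≤n) = Z≋0-below n k k≤n
    ... | inj₂ refl = ι₁-cancel n (at Z (suc n)) (ℚxR.trans (ℚxR.sym (ℚxR.*-identityˡ _)) (ℚxR.trans (ℚxR.*-congʳ (ℚxR.sym c₀≋1))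
            (ℚxR.trans (ℚxR.sym (at-⊛-lowZeros c (∂ Z) n (λ k k<n → ℚxR.trans (ℚxR.*-congˡ {ι₁ (suc k)} (Z≋0-below n (suc k) k<n)) (ℚxR.zeroʳ _))))
            (ℚxR.trans (un ode n) (ℚxR.trans (at-⊛-lowZeros r Z n (λ k k<n → Z≋0-below n k (ℕP.<⇒≤ k<n)))
               (ℚxR.trans (ℚxR.*-congˡ {at r 0} (Z≋0-below n n ℕP.≤-refl)) (ℚxR.zeroʳ _)))))))


module FormalExponential where

  open P using (refl)
  open RationalArithmetic
  open TwoVariableSeries

  invFact : ℕ → ℚ
  invFact k = (+ 1 / (k !)) {{ℕP._!≢0 k}}

  invFact-suc : ∀ k → invFact (suc k) ℚ.* ℤ→ℚ (+ suc k) ≡ invFact k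
  invFact-suc k = P.trans (P.cong (λ z → z ℚ.* ℤ→ℚ (+ suc k)) (/-suc-pred (+ 1) (suc k !) {{ℕP._!≢0 (suc k)}}))
    (P.trans (/-* (+ 1) (+ suc k) (ℕ.pred (suc k !)) 0)
    (P.trans (/-cross (+ 1 ℤ.* + suc k) (+ 1) (ℕ.pred (suc k !) ℕ.* 1) (ℕ.pred (k !)) eq) (P.sym (/-suc-pred (+ 1) (k !) {{ℕP._!≢0 k}}))))
    where
    eq : (+ 1 ℤ.* + suc k) ℤ.* + suc (ℕ.pred (k !)) ≡ + 1 ℤ.* + (suc (ℕ.pred (suc k !)) ℕ.* 1)
    eq = P.trans (P.cong (λ z → (+ 1 ℤ.* + suc k) ℤ.* + z) (ℕP.suc-pred (k !) {{ℕP._!≢0 k}}))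
         (P.trans (P.trans (P.cong (ℤ._* + (k !)) (ℤP.*-identityˡ (+ suc k))) (P.sym (ℤP.pos-* (suc k) (k !))))
         (P.sym (P.trans (ℤP.*-identityˡ _) (P.cong +_ (P.trans (ℕP.*-identityʳ _) (ℕP.suc-pred (suc k !) {{ℕP._!≢0 (suc k)}}))))))

  invFact₁-suc : ∀ k → κ₁ (invFact (suc k)) ⊛₁ ι₁ (suc k) ≋₁ κ₁ (invFact k)
  invFact₁-suc k = ℚxR.trans (ℚxR.*-congˡ {κ₁ (invFact (suc k))} (ℚx.ιₛ≋κ (suc k)))
           (ℚxR.trans (ℚxR.sym (ℚx.κ-* _ _)) (mk≋₁ λ { zero → P.trans (P.cong (λ z → invFact (suc k) ℚ.* z) (ιℚ≡ (suc k))) (invFact-suc k)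
                                                    ; (suc n) → refl }))

  ∑-extend : ∀ a n (F : ℕ → Seriesₓ) → a ℕ.≤ n → (∀ k → a ℕ.< k → F k ≋₁ 𝟘₁) → ∑ a F ≋₁ ∑ n F
  ∑-extend a zero F z≤n h = ℚxR.refl
  ∑-extend a (suc n) F a≤ h with ℕP.m≤n⇒m<n∨m≡n a≤
  ... | inj₂ refl = ℚxR.refl
  ... | inj₁ (s≤s a≤n) = ℚxR.trans (∑-extend a n F a≤n h) (ℚxR.sym (ℚxR.trans (ℚxR.+-congˡ (h (suc n) (s≤s a≤n))) (ℚxR.+-identityʳ _)))

  module Exponential (q : Ser) where
    Q : Series
    Q = embed q
    Qᵏ : ℕ → Series
    Qᵏ = pow Q
    E : Series
    E = embed (expₛ q)

    E-at : ∀ n → at E n ≋₁ ∑ n (λ k → κ₁ (invFact k) ⊛₁ at (Qᵏ k) n)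
    E-at n = mk≋₁ λ i → P.sym (P.trans (at-∑ n _ i) (sumTo-cong n (λ k →
       P.trans (un₁ (ℚx.κ-⊛ (invFact k) (at (Qᵏ k) n)) i)
       (P.trans (ℚP.*-comm (invFact k) _) (P.cong (λ z → z ℚ.* invFact k) (P.sym (un₁ (un (embed-^ₛ q k) n) i)))))))

    module _ (Q₀≋0 : at Q 0 ≋₁ 𝟘₁) where
      pow-lowZeros : ∀ k a → a ℕ.< k → at (Qᵏ k) a ≋₁ 𝟘₁
      pow-lowZeros (suc k) a (s≤s a≤k) = ℚxt.∑-zero a (λ { zero _ → ℚxR.trans (ℚxR.*-congʳ Q₀≋0) (ℚxR.zeroˡ _)
                                               ; (suc b) sb≤a → ℚxR.trans (ℚxR.*-congˡ {at Q (suc b)} (pow-lowZeros k (a ∸ suc b)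
                                                     (ℕP.<-≤-trans (ℕP.∸-monoʳ-< {a} {suc b} {0} (s≤s z≤n) sb≤a) a≤k)))
                                                     (ℚxR.zeroʳ _) })

      ∂-pow : ∀ k → ∂ (Qᵏ (suc k)) ≋ ι₂ (suc k) ⊛ (Qᵏ k ⊛ ∂ Q)
      ∂-pow zero = ℚxtR.trans (ℚxt.∂-⊛ Q 𝟙) (ℚxtR.trans (ℚxtR.+-cong (ℚxtR.*-congˡ (ℚxtR.sym ι₂1≋𝟙)) (ℚxtR.*-congˡ (ℚxt.∂-κ 𝟙₁)))
                  (ℚxtR.trans (identity Q (∂ Q)) (ℚxtR.*-congˡ (ℚxtR.*-congʳ ι₂1≋𝟙))))
        where
        open ℚxtSolver using (_:+_; _:*_; _:=_; con)
        identity : ∀ Q ∂Q → ∂Q ⊛ ι₂ 1 ⊕ Q ⊛ 𝟘 ≋ ι₂ 1 ⊛ (ι₂ 1 ⊛ ∂Q)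
        identity = ℚxtSolver.solve 2 (λ Q ∂Q → ∂Q :* con (+ 1) :+ Q :* con (+ 0) := con (+ 1) :* (con (+ 1) :* ∂Q)) ℚxtR.refl
      ∂-pow (suc k) = ℚxtR.trans (ℚxt.∂-⊛ Q (Qᵏ (suc k)))
                        (ℚxtR.trans (ℚxtR.+-congˡ (ℚxtR.*-congˡ (ℚxtR.trans (∂-pow k) (ℚxtR.*-congʳ (ℚxt.ιₛ-+ 1 k)))))
                                    (ℚxtR.trans (identity Q (∂ Q) (Qᵏ k) (ι₂ k)) (ℚxtR.*-congʳ (ℚxtR.sym (ℚxt.ιₛ-+ 2 k)))))
        where
        open ℚxtSolver using (_:+_; _:*_; _:=_; con)
        identity : ∀ Q ∂Q P N → ∂Q ⊛ (Q ⊛ P) ⊕ Q ⊛ ((ι₂ 1 ⊕ N) ⊛ (P ⊛ ∂Q)) ≋ (ι₂ 2 ⊕ N) ⊛ ((Q ⊛ P) ⊛ ∂Q)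
        identity = ℚxtSolver.solve 4 (λ Q ∂Q P N → ∂Q :* (Q :* P) :+ Q :* ((con (+ 1) :+ N) :* (P :* ∂Q))
                                                  := (con (+ 2) :+ N) :* ((Q :* P) :* ∂Q)) ℚxtR.refl

      invFact₁ : ℕ → Seriesₓ
      invFact₁ k = κ₁ (invFact k)

      x[yz]≈y[xz] : ∀ x y z → x ⊛₁ (y ⊛₁ z) ≋₁ y ⊛₁ (x ⊛₁ z)
      x[yz]≈y[xz] = ℚxSolver.solve 3 (λ x y z → x ℚxSolver.:* (y ℚxSolver.:* z) ℚxSolver.:= y ℚxSolver.:* (x ℚxSolver.:* z)) ℚxR.refl

      at-∂E : ∀ n → at (∂ E) n ≋₁ ∑ n (λ k → invFact₁ k ⊛₁ at (Qᵏ k ⊛ ∂ Q) n)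
      at-∂E n = ℚxR.trans (ℚxR.*-congˡ {ι₁ (suc n)} (E-at (suc n)))
        (ℚxR.trans (ℚxt.∑-*ˡ (suc n) (ι₁ (suc n)) _)
        (ℚxR.trans (ℚxt.∑-cong′ (suc n) (λ k → x[yz]≈y[xz] (ι₁ (suc n)) (invFact₁ k) (at (Qᵏ k) (suc n))))
        (ℚxR.trans (ℚxt.∑-suc n _)
        (ℚxR.trans (ℚxR.+-congʳ (ℚxR.trans (ℚxR.*-congˡ {invFact₁ 0} (ℚxR.zeroʳ (ι₁ (suc n)))) (ℚxR.zeroʳ _)))
        (ℚxR.trans (ℚxR.+-identityˡ _)
        (ℚxt.∑-cong′ n (λ k → ℚxR.trans (ℚxR.*-congˡ {invFact₁ (suc k)} (ℚxR.trans (un (∂-pow k) n) (ℚxt.at-ιₛ⊛ (suc k) (Qᵏ k ⊛ ∂ Q) n)))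
           (ℚxR.trans (ℚxR.sym (ℚxR.*-assoc (invFact₁ (suc k)) (ι₁ (suc k)) _)) (ℚxR.*-congʳ (invFact₁-suc k))))))))))

      at-E⊛∂Q : ∀ n → at (E ⊛ ∂ Q) n ≋₁ ∑ n (λ k → invFact₁ k ⊛₁ at (Qᵏ k ⊛ ∂ Q) n)
      at-E⊛∂Q n = ℚxR.trans (ℚxt.∑-cong n (λ a a≤n → ℚxR.*-congʳ (ℚxR.trans (E-at a)
                 (∑-extend a n _ a≤n (λ k a<k → ℚxR.trans (ℚxR.*-congˡ {invFact₁ k} (pow-lowZeros k a a<k)) (ℚxR.zeroʳ _))))))
        (ℚxR.trans (ℚxt.∑-cong′ n (λ a → ℚxR.trans (ℚxt.∑-*ʳ n _ _) (ℚxt.∑-cong′ n (λ k → ℚxR.*-assoc _ _ _))))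
        (ℚxR.trans (ℚxt.∑-comm n n _)
        (ℚxt.∑-cong′ n (λ k → ℚxR.sym (ℚxt.∑-*ˡ n (invFact₁ k) _)))))

      -- Both sides have tⁿ-coefficient Σₖ (Qᵏ Q′)ₙ / k!; on the right, Q(0) = 0 lets each truncated
      -- sum defining Eₐ be extended to k ≤ n.
      ∂-exp : ∂ E ≋ ∂ Q ⊛ E
      ∂-exp = mk≋ λ n → ℚxR.trans (at-∂E n) (ℚxR.trans (ℚxR.sym (at-E⊛∂Q n)) (un (ℚxt.⊛-comm E (∂ Q)) n))


module EgfODE where

  open P using (refl)
  open RationalArithmetic
  open TwoVariableSeries
  open FormalExponential using (invFact; invFact₁-suc)
  open HermiteDeterminant using (V; Vs; ιℤx; ιℤx≋κ; coeffs-constₚ; coeffs--ₚ; coeffs-Xₚ; coeffs-+ₚ; coeffs-*ₚ; Vs-rec; module ℤx; module ℤxR)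

  ℤx→ℚx : ℤx.Series → Seriesₓ
  at₁ (ℤx→ℚx f) i = ℤ→ℚ (ℤx.at f i)

  ℤx→ℚx-cong : ∀ {f g} → f ℤx.≋ g → ℤx→ℚx f ≋₁ ℤx→ℚx g
  ℤx→ℚx-cong e = mk≋₁ λ i → P.cong ℤ→ℚ (ℤx.un e i)

  ℤx→ℚx-⊕ : ∀ f g → ℤx→ℚx (f ℤx.⊕ g) ≋₁ ℤx→ℚx f ⊕₁ ℤx→ℚx g
  ℤx→ℚx-⊕ f g = mk≋₁ λ i → ℤ→ℚ-+ (ℤx.at f i) (ℤx.at g i)

  ℤx→ℚx-⊝ : ∀ f → ℤx→ℚx (ℤx.⊝ f) ≋₁ ⊝₁ ℤx→ℚx f
  ℤx→ℚx-⊝ f = mk≋₁ λ i → ℤ→ℚ-neg (ℤx.at f i)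

  ℤ→ℚ-∑ : ∀ n F → ℤ→ℚ (ℤx.∑ n F) ≡ ∑₁ n (λ a → ℤ→ℚ (F a))
  ℤ→ℚ-∑ zero F = refl
  ℤ→ℚ-∑ (suc n) F = P.trans (ℤ→ℚ-+ (ℤx.∑ n F) (F (suc n))) (P.cong (ℚ._+ ℤ→ℚ (F (suc n))) (ℤ→ℚ-∑ n F))

  ℤx→ℚx-⊛ : ∀ f g → ℤx→ℚx (f ℤx.⊛ g) ≋₁ ℤx→ℚx f ⊛₁ ℤx→ℚx g
  ℤx→ℚx-⊛ f g = mk≋₁ λ i → P.trans (ℤ→ℚ-∑ i (λ a → ℤx.at f a ℤ.* ℤx.at g (i ∸ a))) (ℚx.∑-cong′ i (λ a → ℤ→ℚ-* (ℤx.at f a) (ℤx.at g (i ∸ a))))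

  ℤx→ℚx-τ : ℤx→ℚx ℤx.τ ≋₁ τ₁
  ℤx→ℚx-τ = mk≋₁ λ { zero → refl ; (suc zero) → refl ; (suc (suc n)) → refl }

  ℤx→ℚx-κ : ∀ z → ℤx→ℚx (ℤx.κ z) ≋₁ κ₁ (ℤ→ℚ z)
  ℤx→ℚx-κ z = mk≋₁ λ { zero → refl ; (suc n) → refl }

  κ₁≋ι₁ : ∀ k → κ₁ (ℤ→ℚ (+ k)) ≋₁ ι₁ k
  κ₁≋ι₁ k = ℚxR.trans (mk≋₁ λ { zero → P.sym (ιℚ≡ k) ; (suc n) → refl }) (ℚxR.sym (ℚx.ιₛ≋κ k))

  ℤx→ℚx-ι : ∀ k → ℤx→ℚx (ιℤx k) ≋₁ ι₁ k
  ℤx→ℚx-ι k = ℚxR.trans (ℤx→ℚx-cong (ιℤx≋κ k)) (ℚxR.trans (ℤx→ℚx-κ (+ k)) (κ₁≋ι₁ k))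

  Vℚ : ℕ → Seriesₓ
  Vℚ k = ℤx→ℚx (Vs k)

  Vℚ-1 : Vℚ 1 ≋₁ ι₁ 1
  Vℚ-1 = ℚxR.trans (ℤx→ℚx-cong (coeffs-constₚ (+ 1))) (ℚxR.trans (ℤx→ℚx-κ (+ 1)) (ℚxR.sym ι₁1≋𝟙))

  Vℚ-2 : Vℚ 2 ≋₁ τ₁ ⊕₁ ⊝₁ ι₁ 1
  Vℚ-2 = ℚxR.trans (ℤx→ℚx-cong (ℤxR.trans (coeffs--ₚ Xₚ (constₚ (+ 1))) (ℤxR.+-cong coeffs-Xₚ (ℤxR.-‿cong (coeffs-constₚ (+ 1))))))
       (ℚxR.trans (ℤx→ℚx-⊕ _ _) (ℚxR.+-cong ℤx→ℚx-τ (ℚxR.trans (ℤx→ℚx-⊝ _) (ℚxR.-‿cong (ℚxR.trans (ℤx→ℚx-κ (+ 1)) (ℚxR.sym ι₁1≋𝟙))))))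

  Vℚ-3 : Vℚ 3 ≋₁ τ₁ ⊛₁ τ₁ ⊕₁ ι₁ 3
  Vℚ-3 = ℚxR.trans (ℤx→ℚx-cong (ℤxR.trans (coeffs-+ₚ (Xₚ *ₚ Xₚ) (constₚ (+ 3))) (ℤxR.+-cong (ℤxR.trans (coeffs-*ₚ Xₚ Xₚ) (ℤxR.*-cong coeffs-Xₚ coeffs-Xₚ)) (coeffs-constₚ (+ 3)))))
       (ℚxR.trans (ℤx→ℚx-⊕ _ _) (ℚxR.+-cong (ℚxR.trans (ℤx→ℚx-⊛ _ _) (ℚxR.*-cong ℤx→ℚx-τ ℤx→ℚx-τ)) (ℚxR.trans (ℤx→ℚx-κ (+ 3)) (κ₁≋ι₁ 3))))

  Vℚ-rec : ∀ m → Vℚ (suc (suc (suc (suc m)))) ≋₁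
     (τ₁ ⊕₁ ι₁ (suc m)) ⊛₁ Vℚ (suc (suc (suc m)))
     ⊕₁ ι₁ (suc (suc m)) ⊛₁ ((τ₁ ⊕₁ ι₁ (suc (suc (suc (suc m))))) ⊛₁ Vℚ (suc (suc m)))
     ⊕₁ ⊝₁ ((ι₁ (suc m) ⊛₁ (ι₁ (suc (suc m)) ⊛₁ ι₁ (suc (suc m)))) ⊛₁ Vℚ (suc m))
  Vℚ-rec m = ℚxR.trans (ℤx→ℚx-cong (Vs-rec m))
    (ℚxR.trans (ℤx→ℚx-⊕ _ _) (ℚxR.+-cong (ℚxR.trans (ℤx→ℚx-⊕ _ _) (ℚxR.+-cong (ℤx→ℚx-[τ+ι]⊛ (suc m) _) (ℚxR.trans (ℤx→ℚx-ι⊛ (suc (suc m)) _) (ℚxR.*-congˡ {ι₁ (suc (suc m))} (ℤx→ℚx-[τ+ι]⊛ (suc (suc (suc (suc m)))) _)))))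
      (ℚxR.trans (ℤx→ℚx-⊝ _) (ℚxR.-‿cong (ℚxR.trans (ℤx→ℚx-⊛ _ _) (ℚxR.*-congʳ (ℚxR.trans (ℤx→ℚx-⊛ _ _) (ℚxR.*-cong (ℤx→ℚx-ι (suc m)) (ℚxR.trans (ℤx→ℚx-⊛ _ _) (ℚxR.*-cong (ℤx→ℚx-ι (suc (suc m))) (ℤx→ℚx-ι (suc (suc m)))))))))))))
    where
    ℤx→ℚx-[τ+ι]⊛ : ∀ k f → ℤx→ℚx ((ℤx.τ ℤx.⊕ ιℤx k) ℤx.⊛ f) ≋₁ (τ₁ ⊕₁ ι₁ k) ⊛₁ ℤx→ℚx f
    ℤx→ℚx-[τ+ι]⊛ k f = ℚxR.trans (ℤx→ℚx-⊛ _ f) (ℚxR.*-congʳ (ℚxR.trans (ℤx→ℚx-⊕ ℤx.τ (ιℤx k)) (ℚxR.+-cong ℤx→ℚx-τ (ℤx→ℚx-ι k))))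
    ℤx→ℚx-ι⊛ : ∀ k f → ℤx→ℚx (ιℤx k ℤx.⊛ f) ≋₁ ι₁ k ⊛₁ ℤx→ℚx f
    ℤx→ℚx-ι⊛ k f = ℚxR.trans (ℤx→ℚx-⊛ (ιℤx k) f) (ℚxR.*-congʳ (ℤx→ℚx-ι k))

  egfV : Series
  egfV = embed (egf V)

  at-egfV : ∀ k → at egfV k ≋₁ κ₁ (invFact k) ⊛₁ Vℚ (suc k)
  at-egfV k = mk≋₁ λ i → P.trans (ℚP.*-comm _ (invFact k)) (P.sym (un₁ (ℚx.κ-⊛ (invFact k) (Vℚ (suc k))) i))

  invFact₁-pred : ∀ k → κ₁ (invFact k) ≋₁ κ₁ (invFact (suc k)) ⊛₁ ι₁ (suc k)
  invFact₁-pred k = ℚxR.sym (invFact₁-suc k)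

  at-∂egfV : ∀ k → at (∂ egfV) k ≋₁ κ₁ (invFact k) ⊛₁ Vℚ (suc (suc k))
  at-∂egfV k = ℚxR.trans (ℚxR.*-congˡ {ι₁ (suc k)} (at-egfV (suc k)))
            (ℚxR.trans (ℚxR.sym (ℚxR.*-assoc _ _ _)) (ℚxR.*-congʳ (ℚxR.trans (ℚxR.*-comm _ _) (invFact₁-suc k))))

  -- egf V solves (1 − t)²(1 + t) F′ = (x(1 + t) + (2t − 1)(1 − t)) F, which is the recurrence (2) multiplied out.
  [1-τ] [1+τ] odeCoeff odeRhs : Series
  [1-τ] = ι₂ 1 ⊕ ⊝ τ
  [1+τ] = ι₂ 1 ⊕ τ
  odeCoeff = [1-τ] ⊛ ([1-τ] ⊛ [1+τ])
  odeRhs = X ⊛ [1+τ] ⊕ (ι₂ 2 ⊛ τ ⊕ ⊝ ι₂ 1) ⊛ [1-τ]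

  module _ where
    open ℚxtSolver using (_:+_; _:*_; :-_; _:=_; con)
    odeCoeff-expand : ∀ T g → (ι₂ 1 ⊕ ⊝ T) ⊛ ((ι₂ 1 ⊕ ⊝ T) ⊛ (ι₂ 1 ⊕ T)) ⊛ g ≋ g ⊕ ⊝ (T ⊛ g) ⊕ ⊝ (T ⊛ (T ⊛ g)) ⊕ T ⊛ (T ⊛ (T ⊛ g))
    odeCoeff-expand = ℚxtSolver.solve 2 (λ T g → (con (+ 1) :+ :- T) :* ((con (+ 1) :+ :- T) :* (con (+ 1) :+ T)) :* g
                         := g :+ :- (T :* g) :+ :- (T :* (T :* g)) :+ T :* (T :* (T :* g))) ℚxtR.refl
    odeRhs-expand : ∀ Xv T g → (Xv ⊛ (ι₂ 1 ⊕ T) ⊕ (ι₂ 2 ⊛ T ⊕ ⊝ ι₂ 1) ⊛ (ι₂ 1 ⊕ ⊝ T)) ⊛ g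
                    ≋ Xv ⊛ g ⊕ Xv ⊛ (T ⊛ g) ⊕ ⊝ g ⊕ ι₂ 3 ⊛ (T ⊛ g) ⊕ ⊝ (ι₂ 2 ⊛ (T ⊛ (T ⊛ g)))
    odeRhs-expand = ℚxtSolver.solve 3 (λ Xv T g → (Xv :* (con (+ 1) :+ T) :+ (con (+ 2) :* T :+ :- con (+ 1)) :* (con (+ 1) :+ :- T)) :* g
                    := Xv :* g :+ Xv :* (T :* g) :+ :- g :+ con (+ 3) :* (T :* g) :+ :- (con (+ 2) :* (T :* (T :* g)))) ℚxtR.refl

  odeCoeff⊛-at : Series → ℕ → Seriesₓ
  odeCoeff⊛-at g n = at g n ⊕₁ ⊝₁ at (shift g) n ⊕₁ ⊝₁ at (shift (shift g)) n ⊕₁ at (shift (shift (shift g))) n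
  odeRhs⊛-at : Series → ℕ → Seriesₓ
  odeRhs⊛-at g n = τ₁ ⊛₁ at g n ⊕₁ τ₁ ⊛₁ at (shift g) n ⊕₁ ⊝₁ at g n ⊕₁ ι₁ 3 ⊛₁ at (shift g) n ⊕₁ ⊝₁ (ι₁ 2 ⊛₁ at (shift (shift g)) n)

  τ²⊛≋shift² : ∀ g → τ ⊛ (τ ⊛ g) ≋ shift (shift g)
  τ²⊛≋shift² g = ℚxtR.trans (ℚxtR.*-congˡ (τ⊛≋shift g)) (τ⊛≋shift (shift g))

  τ³⊛≋shift³ : ∀ g → τ ⊛ (τ ⊛ (τ ⊛ g)) ≋ shift (shift (shift g))
  τ³⊛≋shift³ g = ℚxtR.trans (ℚxtR.*-congˡ (τ²⊛≋shift² g)) (τ⊛≋shift (shift (shift g)))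

  at-odeCoeff⊛ : ∀ g n → at (odeCoeff ⊛ g) n ≋₁ odeCoeff⊛-at g n
  at-odeCoeff⊛ g n = un (ℚxtR.trans (odeCoeff-expand τ g) (ℚxtR.+-cong (ℚxtR.+-cong (ℚxtR.+-congˡ (ℚxtR.-‿cong (τ⊛≋shift g))) (ℚxtR.-‿cong (τ²⊛≋shift² g))) (τ³⊛≋shift³ g))) n

  at-odeRhs⊛ : ∀ g n → at (odeRhs ⊛ g) n ≋₁ odeRhs⊛-at g n
  at-odeRhs⊛ g n = ℚxR.trans (un (odeRhs-expand X τ g) n)
    (ℚxR.+-cong (ℚxR.+-cong (ℚxR.+-cong (ℚxR.+-cong (un (ℚxt.κ-⊛ τ₁ g) n)
       (ℚxR.trans (un (ℚxt.κ-⊛ τ₁ (τ ⊛ g)) n) (ℚxR.*-congˡ {τ₁} (un (τ⊛≋shift g) n)))) ℚxR.refl)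
       (ℚxR.trans (ℚxt.at-ιₛ⊛ 3 (τ ⊛ g) n) (ℚxR.*-congˡ {ι₁ 3} (un (τ⊛≋shift g) n))))
       (ℚxR.-‿cong (ℚxR.trans (ℚxt.at-ιₛ⊛ 2 (τ ⊛ (τ ⊛ g)) n) (ℚxR.*-congˡ {ι₁ 2} (un (τ²⊛≋shift² g) n)))))

  -- The coefficient of tᵐ⁺³ on both sides of egf-ode, in terms of f = 1/(m+3)!, M = m and V(m+3), V(m+4), V(m+5);
  -- as in UShapes, the operations are parameters.
  module EgfShapes {T : Set} (plus times : T → T → T) (neg : T → T) (c₁ c₂ c₃ c₅ : T) where
    infixl 6 _+′_
    infixl 7 _*′_
    _+′_ _*′_ : T → T → T
    _+′_ = plus
    _*′_ = times
    f₂ f₁ f₀ : T → T → T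
    f₂ f M = f *′ (c₃ +′ M)
    f₁ f M = f₂ f M *′ (c₂ +′ M)
    f₀ f M = f₁ f M *′ (c₁ +′ M)
    v₅ : T → T → T → T → T → T
    v₅ X M v₄ v₃ v₂ = (X +′ (c₂ +′ M)) *′ v₄ +′ (c₃ +′ M) *′ ((X +′ (c₅ +′ M)) *′ v₃) +′ neg (((c₂ +′ M) *′ ((c₃ +′ M) *′ (c₃ +′ M))) *′ v₂)
    lhs rhs : T → T → T → T → T → T → T
    lhs X f M v₄ v₃ v₂ = f *′ v₅ X M v₄ v₃ v₂ +′ neg (f₂ f M *′ v₄) +′ neg (f₁ f M *′ v₃) +′ f₀ f M *′ v₂
    rhs X f M v₄ v₃ v₂ = X *′ (f *′ v₄) +′ X *′ (f₂ f M *′ v₃) +′ neg (f *′ v₄) +′ c₃ *′ (f₂ f M *′ v₃) +′ neg (c₂ *′ (f₁ f M *′ v₂))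

  module EgfShapesℚx = EgfShapes _⊕₁_ _⊛₁_ ⊝₁_ (ι₁ 1) (ι₁ 2) (ι₁ 3) (ι₁ 5)
  module EgfShapesSyntax = EgfShapes {ℚxSolver.Polynomial 6} ℚxSolver._:+_ ℚxSolver._:*_ ℚxSolver.:-_ (ℚxSolver.con (+ 1)) (ℚxSolver.con (+ 2)) (ℚxSolver.con (+ 3)) (ℚxSolver.con (+ 5))

  egf-rec-identity : ∀ X f M v₄ v₃ v₂ → EgfShapesℚx.lhs X f M v₄ v₃ v₂ ≋₁ EgfShapesℚx.rhs X f M v₄ v₃ v₂
  egf-rec-identity = ℚxSolver.solve 6 (λ X f M v₄ v₃ v₂ → EgfShapesSyntax.lhs X f M v₄ v₃ v₂ ℚxSolver.:= EgfShapesSyntax.rhs X f M v₄ v₃ v₂) ℚxR.refl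

  module _ where
    open ℚxSolver using (_:+_; _:*_; :-_; _:=_; con)
    egf-identity₂ : ∀ Xv h v₃ v₂ v₁ →
      h ⊛₁ ((Xv ⊕₁ ι₁ 1) ⊛₁ v₃ ⊕₁ ι₁ 2 ⊛₁ ((Xv ⊕₁ ι₁ 4) ⊛₁ v₂) ⊕₁ ⊝₁ ((ι₁ 1 ⊛₁ (ι₁ 2 ⊛₁ ι₁ 2)) ⊛₁ v₁))
        ⊕₁ ⊝₁ ((h ⊛₁ ι₁ 2) ⊛₁ v₃) ⊕₁ ⊝₁ (((h ⊛₁ ι₁ 2) ⊛₁ ι₁ 1) ⊛₁ v₂) ⊕₁ 𝟘₁
      ≋₁ Xv ⊛₁ (h ⊛₁ v₃) ⊕₁ Xv ⊛₁ ((h ⊛₁ ι₁ 2) ⊛₁ v₂) ⊕₁ ⊝₁ (h ⊛₁ v₃) ⊕₁ ι₁ 3 ⊛₁ ((h ⊛₁ ι₁ 2) ⊛₁ v₂)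
        ⊕₁ ⊝₁ (ι₁ 2 ⊛₁ (((h ⊛₁ ι₁ 2) ⊛₁ ι₁ 1) ⊛₁ v₁))
    egf-identity₂ = ℚxSolver.solve 5 (λ Xv h v₃ v₂ v₁ →
      h :* ((Xv :+ con (+ 1)) :* v₃ :+ con (+ 2) :* ((Xv :+ con (+ 4)) :* v₂) :+ :- ((con (+ 1) :* (con (+ 2) :* con (+ 2))) :* v₁))
        :+ :- ((h :* con (+ 2)) :* v₃) :+ :- (((h :* con (+ 2)) :* con (+ 1)) :* v₂) :+ con (+ 0)
      := Xv :* (h :* v₃) :+ Xv :* ((h :* con (+ 2)) :* v₂) :+ :- (h :* v₃) :+ con (+ 3) :* ((h :* con (+ 2)) :* v₂)
        :+ :- (con (+ 2) :* (((h :* con (+ 2)) :* con (+ 1)) :* v₁))) ℚxR.refl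
    egf-identity₁ : ∀ Xv h →
      h ⊛₁ (Xv ⊛₁ Xv ⊕₁ ι₁ 3) ⊕₁ ⊝₁ ((h ⊛₁ ι₁ 1) ⊛₁ (Xv ⊕₁ ⊝₁ ι₁ 1)) ⊕₁ ⊝₁ 𝟘₁ ⊕₁ 𝟘₁
      ≋₁ Xv ⊛₁ (h ⊛₁ (Xv ⊕₁ ⊝₁ ι₁ 1)) ⊕₁ Xv ⊛₁ ((h ⊛₁ ι₁ 1) ⊛₁ ι₁ 1) ⊕₁ ⊝₁ (h ⊛₁ (Xv ⊕₁ ⊝₁ ι₁ 1))
        ⊕₁ ι₁ 3 ⊛₁ ((h ⊛₁ ι₁ 1) ⊛₁ ι₁ 1) ⊕₁ ⊝₁ (ι₁ 2 ⊛₁ 𝟘₁)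
    egf-identity₁ = ℚxSolver.solve 2 (λ Xv h →
      h :* (Xv :* Xv :+ con (+ 3)) :+ :- ((h :* con (+ 1)) :* (Xv :+ :- con (+ 1))) :+ :- con (+ 0) :+ con (+ 0)
      := Xv :* (h :* (Xv :+ :- con (+ 1))) :+ Xv :* ((h :* con (+ 1)) :* con (+ 1)) :+ :- (h :* (Xv :+ :- con (+ 1)))
        :+ con (+ 3) :* ((h :* con (+ 1)) :* con (+ 1)) :+ :- (con (+ 2) :* con (+ 0))) ℚxR.refl
    egf-identity₀ : ∀ Xv h →
      h ⊛₁ (Xv ⊕₁ ⊝₁ ι₁ 1) ⊕₁ ⊝₁ 𝟘₁ ⊕₁ ⊝₁ 𝟘₁ ⊕₁ 𝟘₁
      ≋₁ Xv ⊛₁ (h ⊛₁ ι₁ 1) ⊕₁ Xv ⊛₁ 𝟘₁ ⊕₁ ⊝₁ (h ⊛₁ ι₁ 1) ⊕₁ ι₁ 3 ⊛₁ 𝟘₁ ⊕₁ ⊝₁ (ι₁ 2 ⊛₁ 𝟘₁)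
    egf-identity₀ = ℚxSolver.solve 2 (λ Xv h →
      h :* (Xv :+ :- con (+ 1)) :+ :- con (+ 0) :+ :- con (+ 0) :+ con (+ 0)
      := Xv :* (h :* con (+ 1)) :+ Xv :* con (+ 0) :+ :- (h :* con (+ 1)) :+ con (+ 3) :* con (+ 0) :+ :- (con (+ 2) :* con (+ 0))) ℚxR.refl

  egf-ode-at : ∀ n → odeCoeff⊛-at (∂ egfV) n ≋₁ odeRhs⊛-at egfV n
  egf-ode-at zero = ℚxR.trans (ℚxR.+-congʳ (ℚxR.+-congʳ (ℚxR.+-congʳ (ℚxR.trans (at-∂egfV 0) (ℚxR.*-congˡ Vℚ-2)))))
    (ℚxR.trans (egf-identity₀ τ₁ (κ₁ (invFact 0)))
    (ℚxR.sym (ℚxR.+-congʳ (ℚxR.+-cong (ℚxR.+-cong (ℚxR.+-congʳ (ℚxR.*-congˡ (ℚxR.trans (at-egfV 0) (ℚxR.*-congˡ Vℚ-1)))) (ℚxR.-‿cong (ℚxR.trans (at-egfV 0) (ℚxR.*-congˡ Vℚ-1)))) ℚxR.refl))))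
  egf-ode-at (suc zero) = ℚxR.trans (ℚxR.+-congʳ (ℚxR.+-congʳ (ℚxR.+-cong (ℚxR.trans (at-∂egfV 1) (ℚxR.*-congˡ Vℚ-3))
       (ℚxR.-‿cong (ℚxR.trans (at-∂egfV 0) (ℚxR.*-cong (invFact₁-pred 0) Vℚ-2))))))
    (ℚxR.trans (egf-identity₁ τ₁ (κ₁ (invFact 1)))
    (ℚxR.sym (ℚxR.+-congʳ (ℚxR.+-cong (ℚxR.+-cong (ℚxR.+-cong (ℚxR.*-congˡ (ℚxR.trans (at-egfV 1) (ℚxR.*-congˡ Vℚ-2)))
          (ℚxR.*-congˡ (ℚxR.trans (at-egfV 0) (ℚxR.*-cong (invFact₁-pred 0) Vℚ-1)))) (ℚxR.-‿cong (ℚxR.trans (at-egfV 1) (ℚxR.*-congˡ Vℚ-2))))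
       (ℚxR.*-congˡ (ℚxR.trans (at-egfV 0) (ℚxR.*-cong (invFact₁-pred 0) Vℚ-1)))))))
  egf-ode-at (suc (suc zero)) = ℚxR.trans (ℚxR.+-congʳ (ℚxR.+-cong (ℚxR.+-cong (ℚxR.trans (at-∂egfV 2) (ℚxR.*-congˡ (Vℚ-rec 0)))
       (ℚxR.-‿cong (ℚxR.trans (at-∂egfV 1) (ℚxR.*-congʳ (invFact₁-pred 1))))) (ℚxR.-‿cong (ℚxR.trans (at-∂egfV 0) (ℚxR.*-congʳ (ℚxR.trans (invFact₁-pred 0) (ℚxR.*-congʳ (invFact₁-pred 1))))))))
    (ℚxR.trans (egf-identity₂ τ₁ (κ₁ (invFact 2)) (Vℚ 3) (Vℚ 2) (Vℚ 1))
    (ℚxR.sym (ℚxR.+-cong (ℚxR.+-cong (ℚxR.+-cong (ℚxR.+-cong (ℚxR.*-congˡ (at-egfV 2)) (ℚxR.*-congˡ (ℚxR.trans (at-egfV 1) (ℚxR.*-congʳ (invFact₁-pred 1)))))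
          (ℚxR.-‿cong (at-egfV 2))) (ℚxR.*-congˡ (ℚxR.trans (at-egfV 1) (ℚxR.*-congʳ (invFact₁-pred 1)))))
       (ℚxR.-‿cong (ℚxR.*-congˡ (ℚxR.trans (at-egfV 0) (ℚxR.*-congʳ (ℚxR.trans (invFact₁-pred 0) (ℚxR.*-congʳ (invFact₁-pred 1))))))))))
  egf-ode-at (suc (suc (suc m))) = ℚxR.trans lhs-at (ℚxR.trans (egf-rec-identity τ₁ f M (Vℚ (suc (suc (suc (suc m))))) (Vℚ (suc (suc (suc m)))) (Vℚ (suc (suc m)))) (ℚxR.sym rhs-at))
    where
    f = κ₁ (invFact (suc (suc (suc m))))
    M = ι₁ m
    f₂≋ : κ₁ (invFact (suc (suc m))) ≋₁ EgfShapesℚx.f₂ f M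
    f₂≋ = ℚxR.trans (invFact₁-pred (suc (suc m))) (ℚxR.*-congˡ {f} (ℚx.ιₛ-+ 3 m))
    f₁≋ : κ₁ (invFact (suc m)) ≋₁ EgfShapesℚx.f₁ f M
    f₁≋ = ℚxR.trans (invFact₁-pred (suc m)) (ℚxR.*-cong f₂≋ (ℚx.ιₛ-+ 2 m))
    f₀≋ : κ₁ (invFact m) ≋₁ EgfShapesℚx.f₀ f M
    f₀≋ = ℚxR.trans (invFact₁-pred m) (ℚxR.*-cong f₁≋ (ℚx.ιₛ-+ 1 m))
    V₅≋ : Vℚ (suc (suc (suc (suc (suc m))))) ≋₁ EgfShapesℚx.v₅ τ₁ M (Vℚ (suc (suc (suc (suc m))))) (Vℚ (suc (suc (suc m)))) (Vℚ (suc (suc m)))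
    V₅≋ = ℚxR.trans (Vℚ-rec (suc m)) (ℚxR.+-cong (ℚxR.+-cong (ℚxR.*-congʳ (ℚxR.+-congˡ (ℚx.ιₛ-+ 2 m)))
            (ℚxR.*-cong (ℚx.ιₛ-+ 3 m) (ℚxR.*-congʳ (ℚxR.+-congˡ (ℚx.ιₛ-+ 5 m)))))
            (ℚxR.-‿cong (ℚxR.*-congʳ (ℚxR.*-cong (ℚx.ιₛ-+ 2 m) (ℚxR.*-cong (ℚx.ιₛ-+ 3 m) (ℚx.ιₛ-+ 3 m))))))
    lhs-at : odeCoeff⊛-at (∂ egfV) (suc (suc (suc m))) ≋₁ EgfShapesℚx.lhs τ₁ f M (Vℚ (suc (suc (suc (suc m))))) (Vℚ (suc (suc (suc m)))) (Vℚ (suc (suc m)))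
    lhs-at = ℚxR.+-cong (ℚxR.+-cong (ℚxR.+-cong (ℚxR.trans (at-∂egfV (suc (suc (suc m)))) (ℚxR.*-congˡ {f} V₅≋))
            (ℚxR.-‿cong (ℚxR.trans (at-∂egfV (suc (suc m))) (ℚxR.*-congʳ f₂≋))))
            (ℚxR.-‿cong (ℚxR.trans (at-∂egfV (suc m)) (ℚxR.*-congʳ f₁≋))))
            (ℚxR.trans (at-∂egfV m) (ℚxR.*-congʳ f₀≋))
    rhs-at : odeRhs⊛-at egfV (suc (suc (suc m))) ≋₁ EgfShapesℚx.rhs τ₁ f M (Vℚ (suc (suc (suc (suc m))))) (Vℚ (suc (suc (suc m)))) (Vℚ (suc (suc m)))
    rhs-at = ℚxR.+-cong (ℚxR.+-cong (ℚxR.+-cong (ℚxR.+-cong (ℚxR.*-congˡ {τ₁} (at-egfV (suc (suc (suc m)))))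
            (ℚxR.*-congˡ {τ₁} (ℚxR.trans (at-egfV (suc (suc m))) (ℚxR.*-congʳ f₂≋))))
            (ℚxR.-‿cong (at-egfV (suc (suc (suc m))))))
            (ℚxR.*-congˡ {ι₁ 3} (ℚxR.trans (at-egfV (suc (suc m))) (ℚxR.*-congʳ f₂≋))))
            (ℚxR.-‿cong (ℚxR.*-congˡ {ι₁ 2} (ℚxR.trans (at-egfV (suc m)) (ℚxR.*-congʳ f₁≋))))

  egf-ode : odeCoeff ⊛ ∂ egfV ≋ odeRhs ⊛ egfV
  egf-ode = mk≋ λ n → ℚxR.trans (at-odeCoeff⊛ (∂ egfV) n) (ℚxR.trans (egf-ode-at n) (ℚxR.sym (at-odeRhs⊛ egfV n)))


module GeneratingFunction where

  open P using (refl)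
  open TwoVariableSeries
  open FormalODE using (ode-unique)
  open FormalExponential using (module Exponential)
  open EgfODE
  open HermiteDeterminant using (V)

  ∂ι₂1≋𝟘 : ∂ (ι₂ 1) ≋ 𝟘
  ∂ι₂1≋𝟘 = ℚxtR.trans (ℚxt.∂-cong (ℚxt.ιₛ≋κ 1)) (ℚxt.∂-κ (ι₁ 1))

  ∂X≋𝟘 : ∂ X ≋ 𝟘
  ∂X≋𝟘 = ℚxt.∂-κ τ₁

  half : Series
  half = κ (κ₁ (+ 1 / 2))

  half⊛2≋1 : half ⊛ ι₂ 2 ≋ ι₂ 1
  half⊛2≋1 = mk≋ λ n → ℚxR.trans (un (ℚxt.⊛-comm half (ι₂ 2)) n) (ℚxR.trans (ℚxt.at-ιₛ⊛ 2 half n) (half⊛2-at n))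
    where
    half⊛2-at : ∀ n → ι₁ 2 ⊛₁ at half n ≋₁ at (ι₂ 1) n
    half⊛2-at zero = mk≋₁ λ i → P.trans (ℚx.at-ιₛ⊛ 2 (κ₁ (+ 1 / 2)) i) (half*2 i)
      where
      half*2 : ∀ i → ιℚ 2 ℚ.* at₁ (κ₁ (+ 1 / 2)) i ≡ at₁ (at (ι₂ 1) 0) i
      half*2 zero = refl
      half*2 (suc i) = refl
    half⊛2-at (suc n) = mk≋₁ (ℚx.at-ιₛ⊛ 2 𝟘₁)

  oneₛ≡𝟙₁ : ∀ i → oneₛ 0 i ≡ at₁ 𝟙₁ i
  oneₛ≡𝟙₁ zero = refl
  oneₛ≡𝟙₁ (suc i) = refl

  module EgfIdentity (q s : Ser) (q[1-t]≈xt : (q *ₛ (oneₛ -ₛ tₛ)) ≈ₛ (xₛ *ₛ tₛ)) (s₀≡1 : ∀ i → s 0 i ≡ oneₛ 0 i)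
               (s²≈1-t² : (s *ₛ s) ≈ₛ (oneₛ -ₛ tₛ *ₛ tₛ)) where
    open Exponential q
    S : Series
    S = embed s
    embed-[1-t] : embed (oneₛ -ₛ tₛ) ≋ [1-τ]
    embed-[1-t] = ℚxtR.trans (embed--ₛ oneₛ tₛ) (ℚxtR.+-cong (ℚxtR.trans embed-oneₛ (ℚxtR.sym ι₂1≋𝟙)) (ℚxtR.-‿cong embed-tₛ))
    embed-[1+t] : embed (oneₛ +ₛ tₛ) ≋ [1+τ]
    embed-[1+t] = ℚxtR.trans (embed-+ₛ oneₛ tₛ) (ℚxtR.+-cong (ℚxtR.trans embed-oneₛ (ℚxtR.sym ι₂1≋𝟙)) embed-tₛ)
    Q[1-τ]≋Xτ : Q ⊛ [1-τ] ≋ X ⊛ τ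
    Q[1-τ]≋Xτ = ℚxtR.trans (ℚxtR.sym (ℚxtR.trans (embed-*ₛ q _) (ℚxtR.*-congˡ embed-[1-t])))
          (ℚxtR.trans (embed-cong q[1-t]≈xt) (ℚxtR.trans (embed-*ₛ xₛ tₛ) (ℚxtR.*-cong embed-xₛ embed-tₛ)))
    S²≋1-τ² : S ⊛ S ≋ ι₂ 1 ⊕ ⊝ (τ ⊛ τ)
    S²≋1-τ² = ℚxtR.trans (ℚxtR.sym (embed-*ₛ s s)) (ℚxtR.trans (embed-cong s²≈1-t²)
          (ℚxtR.trans (embed--ₛ oneₛ (tₛ *ₛ tₛ)) (ℚxtR.+-cong (ℚxtR.trans embed-oneₛ (ℚxtR.sym ι₂1≋𝟙))
             (ℚxtR.-‿cong (ℚxtR.trans (embed-*ₛ tₛ tₛ) (ℚxtR.*-cong embed-tₛ embed-tₛ))))))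

    Q₀≋0 : at Q 0 ≋₁ 𝟘₁
    Q₀≋0 = ℚxR.trans (*-[1-0] (at Q 0)) (ℚxR.trans (un Q[1-τ]≋Xτ 0) (ℚxR.zeroʳ τ₁))
      where
      *-[1-0] : ∀ a → a ≋₁ a ⊛₁ (ι₁ 1 ⊕₁ ⊝₁ 𝟘₁)
      *-[1-0] = ℚxSolver.solve 1 (λ a → a ℚxSolver.:= a ℚxSolver.:* (ℚxSolver.con (+ 1) ℚxSolver.:+ ℚxSolver.:- ℚxSolver.con (+ 0))) ℚxR.refl

    ∂[Q[1-τ]] : ∂ Q ⊛ [1-τ] ⊕ Q ⊛ (𝟘 ⊕ ⊝ ι₂ 1) ≋ 𝟘 ⊛ τ ⊕ X ⊛ ι₂ 1
    ∂[Q[1-τ]] = ℚxtR.trans (ℚxtR.sym (ℚxtR.trans (ℚxt.∂-⊛ Q [1-τ]) (ℚxtR.+-congˡ (ℚxtR.*-congˡ (ℚxtR.trans (ℚxt.∂-⊕ (ι₂ 1) (⊝ τ))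
              (ℚxtR.+-cong ∂ι₂1≋𝟘 (ℚxtR.trans (ℚxt.∂-⊝ τ) (ℚxtR.-‿cong ℚxt.∂τ≋ιₛ1))))))))
          (ℚxtR.trans (ℚxt.∂-cong Q[1-τ]≋Xτ) (ℚxtR.trans (ℚxt.∂-⊛ X τ) (ℚxtR.+-cong (ℚxtR.*-congʳ ∂X≋𝟘) (ℚxtR.*-congˡ ℚxt.∂τ≋ιₛ1))))

    module _ where
      open ℚxtSolver using (_:+_; _:*_; :-_; _:=_; con)
      Q-ode-expand : ∀ T Q dQ → (ι₂ 1 ⊕ ⊝ T) ⊛ ((ι₂ 1 ⊕ ⊝ T) ⊛ dQ) ≋ (ι₂ 1 ⊕ ⊝ T) ⊛ (dQ ⊛ (ι₂ 1 ⊕ ⊝ T) ⊕ Q ⊛ (𝟘 ⊕ ⊝ ι₂ 1)) ⊕ Q ⊛ (ι₂ 1 ⊕ ⊝ T)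
      Q-ode-expand = ℚxtSolver.solve 3 (λ T Q dQ → (con (+ 1) :+ :- T) :* ((con (+ 1) :+ :- T) :* dQ)
             := (con (+ 1) :+ :- T) :* (dQ :* (con (+ 1) :+ :- T) :+ Q :* (con (+ 0) :+ :- con (+ 1))) :+ Q :* (con (+ 1) :+ :- T)) ℚxtR.refl
      Q-ode-collect : ∀ T Xv → (ι₂ 1 ⊕ ⊝ T) ⊛ (𝟘 ⊛ T ⊕ Xv ⊛ ι₂ 1) ⊕ Xv ⊛ T ≋ Xv
      Q-ode-collect = ℚxtSolver.solve 2 (λ T Xv → (con (+ 1) :+ :- T) :* (con (+ 0) :* T :+ Xv :* con (+ 1)) :+ Xv :* T := Xv) ℚxtR.refl
      E-ode-expand : ∀ T dQ E → (ι₂ 1 ⊕ ⊝ T) ⊛ ((ι₂ 1 ⊕ ⊝ T) ⊛ (ι₂ 1 ⊕ T)) ⊛ (dQ ⊛ E) ≋ (ι₂ 1 ⊕ T) ⊛ (((ι₂ 1 ⊕ ⊝ T) ⊛ ((ι₂ 1 ⊕ ⊝ T) ⊛ dQ)) ⊛ E)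
      E-ode-expand = ℚxtSolver.solve 3 (λ T dQ E → (con (+ 1) :+ :- T) :* ((con (+ 1) :+ :- T) :* (con (+ 1) :+ T)) :* (dQ :* E)
             := (con (+ 1) :+ T) :* (((con (+ 1) :+ :- T) :* ((con (+ 1) :+ :- T) :* dQ)) :* E)) ℚxtR.refl
      E-ode-collect : ∀ T Xv E → (ι₂ 1 ⊕ T) ⊛ (Xv ⊛ E) ≋ (Xv ⊛ (ι₂ 1 ⊕ T)) ⊛ E
      E-ode-collect = ℚxtSolver.solve 3 (λ T Xv E → (con (+ 1) :+ T) :* (Xv :* E) := (Xv :* (con (+ 1) :+ T)) :* E) ℚxtR.refl
      ∂-square : ∀ S dS → dS ⊛ S ⊕ S ⊛ dS ≋ ι₂ 2 ⊛ (S ⊛ dS)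
      ∂-square = ℚxtSolver.solve 2 (λ S dS → dS :* S :+ S :* dS := con (+ 2) :* (S :* dS)) ℚxtR.refl
      ∂[1-τ²]-expand : ∀ T → 𝟘 ⊕ ⊝ (ι₂ 1 ⊛ T ⊕ T ⊛ ι₂ 1) ≋ ⊝ (ι₂ 2 ⊛ T)
      ∂[1-τ²]-expand = ℚxtSolver.solve 1 (λ T → con (+ 0) :+ :- (con (+ 1) :* T :+ T :* con (+ 1)) := :- (con (+ 2) :* T)) ℚxtR.refl
      ι₂1⊛-identity : ∀ y → y ≋ ι₂ 1 ⊛ y
      ι₂1⊛-identity = ℚxtSolver.solve 1 (λ y → y := con (+ 1) :* y) ℚxtR.refl
      ⊛-neg-assoc : ∀ h T → h ⊛ ⊝ (ι₂ 2 ⊛ T) ≋ ⊝ ((h ⊛ ι₂ 2) ⊛ T)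
      ⊛-neg-assoc = ℚxtSolver.solve 2 (λ h T → h :* :- (con (+ 2) :* T) := :- ((h :* con (+ 2)) :* T)) ℚxtR.refl
      neg-ι₂1⊛ : ∀ T → ⊝ (ι₂ 1 ⊛ T) ≋ ⊝ T
      neg-ι₂1⊛ = ℚxtSolver.solve 1 (λ T → :- (con (+ 1) :* T) := :- T) ℚxtR.refl
      G-ode-expand : ∀ T S dS → (ι₂ 1 ⊕ ⊝ (T ⊛ T)) ⊛ ((𝟘 ⊕ ι₂ 1) ⊛ S ⊕ (ι₂ 1 ⊕ T) ⊛ dS)
                     ≋ (ι₂ 1 ⊕ ⊝ (T ⊛ T)) ⊛ ((𝟘 ⊕ ι₂ 1) ⊛ S) ⊕ (ι₂ 1 ⊕ T) ⊛ ((ι₂ 1 ⊕ ⊝ (T ⊛ T)) ⊛ dS)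
      G-ode-expand = ℚxtSolver.solve 3 (λ T S dS → (con (+ 1) :+ :- (T :* T)) :* ((con (+ 0) :+ con (+ 1)) :* S :+ (con (+ 1) :+ T) :* dS)
                     := (con (+ 1) :+ :- (T :* T)) :* ((con (+ 0) :+ con (+ 1)) :* S) :+ (con (+ 1) :+ T) :* ((con (+ 1) :+ :- (T :* T)) :* dS)) ℚxtR.refl
      G-ode-collect : ∀ T S → (ι₂ 1 ⊕ ⊝ (T ⊛ T)) ⊛ ((𝟘 ⊕ ι₂ 1) ⊛ S) ⊕ (ι₂ 1 ⊕ T) ⊛ (S ⊛ ⊝ T) ≋ (ι₂ 1 ⊕ ⊝ (ι₂ 2 ⊛ T)) ⊛ ((ι₂ 1 ⊕ T) ⊛ S)
      G-ode-collect = ℚxtSolver.solve 2 (λ T S → (con (+ 1) :+ :- (T :* T)) :* ((con (+ 0) :+ con (+ 1)) :* S) :+ (con (+ 1) :+ T) :* (S :* :- T)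
                     := (con (+ 1) :+ :- (con (+ 2) :* T)) :* ((con (+ 1) :+ T) :* S)) ℚxtR.refl
      L-ode-expand : ∀ T dF G egfV dG → (ι₂ 1 ⊕ ⊝ T) ⊛ ((ι₂ 1 ⊕ ⊝ T) ⊛ (ι₂ 1 ⊕ T)) ⊛ (dF ⊛ G ⊕ egfV ⊛ dG)
                         ≋ ((ι₂ 1 ⊕ ⊝ T) ⊛ ((ι₂ 1 ⊕ ⊝ T) ⊛ (ι₂ 1 ⊕ T)) ⊛ dF) ⊛ G ⊕ ((ι₂ 1 ⊕ ⊝ T) ⊛ egfV) ⊛ ((ι₂ 1 ⊕ ⊝ (T ⊛ T)) ⊛ dG)
      L-ode-expand = ℚxtSolver.solve 5 (λ T dF G egfV dG → (con (+ 1) :+ :- T) :* ((con (+ 1) :+ :- T) :* (con (+ 1) :+ T)) :* (dF :* G :+ egfV :* dG)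
                         := ((con (+ 1) :+ :- T) :* ((con (+ 1) :+ :- T) :* (con (+ 1) :+ T)) :* dF) :* G :+ ((con (+ 1) :+ :- T) :* egfV) :* ((con (+ 1) :+ :- (T :* T)) :* dG)) ℚxtR.refl
      L-ode-collect : ∀ Xv T egfV G → ((Xv ⊛ (ι₂ 1 ⊕ T) ⊕ (ι₂ 2 ⊛ T ⊕ ⊝ ι₂ 1) ⊛ (ι₂ 1 ⊕ ⊝ T)) ⊛ egfV) ⊛ G ⊕ ((ι₂ 1 ⊕ ⊝ T) ⊛ egfV) ⊛ ((ι₂ 1 ⊕ ⊝ (ι₂ 2 ⊛ T)) ⊛ G)
                       ≋ (Xv ⊛ (ι₂ 1 ⊕ T)) ⊛ (egfV ⊛ G)
      L-ode-collect = ℚxtSolver.solve 4 (λ Xv T egfV G → ((Xv :* (con (+ 1) :+ T) :+ (con (+ 2) :* T :+ :- con (+ 1)) :* (con (+ 1) :+ :- T)) :* egfV) :* G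
                                      :+ ((con (+ 1) :+ :- T) :* egfV) :* ((con (+ 1) :+ :- (con (+ 2) :* T)) :* G)
                       := (Xv :* (con (+ 1) :+ T)) :* (egfV :* G)) ℚxtR.refl
      distrib-⊝ : ∀ c dL dE → c ⊛ (dL ⊕ ⊝ dE) ≋ c ⊛ dL ⊕ ⊝ (c ⊛ dE)
      distrib-⊝ = ℚxtSolver.solve 3 (λ c dL dE → c :* (dL :+ :- dE) := c :* dL :+ :- (c :* dE)) ℚxtR.refl
      factor-⊝ : ∀ r L E → r ⊛ L ⊕ ⊝ (r ⊛ E) ≋ r ⊛ (L ⊕ ⊝ E)
      factor-⊝ = ℚxtSolver.solve 3 (λ r L E → r :* L :+ :- (r :* E) := r :* (L :+ :- E)) ℚxtR.refl
      sub-add : ∀ L E → L ≋ (L ⊕ ⊝ E) ⊕ E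
      sub-add = ℚxtSolver.solve 2 (λ L E → L := (L :+ :- E) :+ E) ℚxtR.refl

    Q-ode : [1-τ] ⊛ ([1-τ] ⊛ ∂ Q) ≋ X
    Q-ode = ℚxtR.trans (Q-ode-expand τ Q (∂ Q)) (ℚxtR.trans (ℚxtR.+-cong (ℚxtR.*-congˡ ∂[Q[1-τ]]) Q[1-τ]≋Xτ) (Q-ode-collect τ X))

    E-ode : odeCoeff ⊛ ∂ E ≋ (X ⊛ [1+τ]) ⊛ E
    E-ode = ℚxtR.trans (ℚxtR.*-congˡ (∂-exp Q₀≋0)) (ℚxtR.trans (E-ode-expand τ (∂ Q) E) (ℚxtR.trans (ℚxtR.*-congˡ (ℚxtR.*-congʳ Q-ode)) (E-ode-collect τ X E)))

    ∂[S²] : ∂ S ⊛ S ⊕ S ⊛ ∂ S ≋ 𝟘 ⊕ ⊝ (ι₂ 1 ⊛ τ ⊕ τ ⊛ ι₂ 1)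
    ∂[S²] = ℚxtR.trans (ℚxtR.sym (ℚxt.∂-⊛ S S)) (ℚxtR.trans (ℚxt.∂-cong S²≋1-τ²)
          (ℚxtR.trans (ℚxt.∂-⊕ (ι₂ 1) _) (ℚxtR.+-cong ∂ι₂1≋𝟘 (ℚxtR.trans (ℚxt.∂-⊝ (τ ⊛ τ))
            (ℚxtR.-‿cong (ℚxtR.trans (ℚxt.∂-⊛ τ τ) (ℚxtR.+-cong (ℚxtR.*-congʳ ℚxt.∂τ≋ιₛ1) (ℚxtR.*-congˡ ℚxt.∂τ≋ιₛ1))))))))

    S∂S≋-τ : S ⊛ ∂ S ≋ ⊝ τ
    S∂S≋-τ = ℚxtR.trans (ι₂1⊛-identity _) (ℚxtR.trans (ℚxtR.*-congʳ (ℚxtR.sym half⊛2≋1)) (ℚxtR.trans (ℚxtR.*-assoc half (ι₂ 2) _)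
          (ℚxtR.trans (ℚxtR.*-congˡ (ℚxtR.trans (ℚxtR.sym (∂-square S (∂ S))) (ℚxtR.trans ∂[S²] (∂[1-τ²]-expand τ))))
          (ℚxtR.trans (⊛-neg-assoc half τ) (ℚxtR.trans (ℚxtR.-‿cong (ℚxtR.*-congʳ half⊛2≋1)) (neg-ι₂1⊛ τ))))))

    G : Series
    G = [1+τ] ⊛ S

    ∂[1+τ] : ∂ [1+τ] ≋ 𝟘 ⊕ ι₂ 1
    ∂[1+τ] = ℚxtR.trans (ℚxt.∂-⊕ (ι₂ 1) τ) (ℚxtR.+-cong ∂ι₂1≋𝟘 ℚxt.∂τ≋ιₛ1)

    G-ode : (ι₂ 1 ⊕ ⊝ (τ ⊛ τ)) ⊛ ∂ G ≋ (ι₂ 1 ⊕ ⊝ (ι₂ 2 ⊛ τ)) ⊛ G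
    G-ode = ℚxtR.trans (ℚxtR.*-congˡ (ℚxtR.trans (ℚxt.∂-⊛ [1+τ] S) (ℚxtR.+-congʳ (ℚxtR.*-congʳ ∂[1+τ]))))
           (ℚxtR.trans (G-ode-expand τ S (∂ S))
           (ℚxtR.trans (ℚxtR.+-congˡ (ℚxtR.*-congˡ (ℚxtR.trans (ℚxtR.*-congʳ (ℚxtR.sym S²≋1-τ²)) (ℚxtR.trans (ℚxtR.*-assoc S S (∂ S)) (ℚxtR.*-congˡ S∂S≋-τ)))))
           (G-ode-collect τ S)))

    L : Series
    L = egfV ⊛ G

    L-ode : odeCoeff ⊛ ∂ L ≋ (X ⊛ [1+τ]) ⊛ L
    L-ode = ℚxtR.trans (ℚxtR.*-congˡ (ℚxt.∂-⊛ egfV G)) (ℚxtR.trans (L-ode-expand τ (∂ egfV) G egfV (∂ G))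
           (ℚxtR.trans (ℚxtR.+-cong (ℚxtR.*-congʳ egf-ode) (ℚxtR.*-congˡ G-ode)) (L-ode-collect X τ egfV G)))

    Z : Series
    Z = L ⊕ ⊝ E

    Z-ode : odeCoeff ⊛ ∂ Z ≋ (X ⊛ [1+τ]) ⊛ Z
    Z-ode = ℚxtR.trans (ℚxtR.*-congˡ (ℚxtR.trans (ℚxt.∂-⊕ L (⊝ E)) (ℚxtR.+-congˡ (ℚxt.∂-⊝ E))))
           (ℚxtR.trans (distrib-⊝ odeCoeff (∂ L) (∂ E)) (ℚxtR.trans (ℚxtR.+-cong L-ode (ℚxtR.-‿cong E-ode)) (factor-⊝ (X ⊛ [1+τ]) L E)))

    odeCoeff₀≋1 : at odeCoeff 0 ≋₁ 𝟙₁
    odeCoeff₀≋1 = ℚxR.trans [1-0]²[1+0] ι₁1≋𝟙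
      where
      open ℚxSolver using (_:+_; _:*_; :-_; _:=_; con)
      [1-0]²[1+0] : (ι₁ 1 ⊕₁ ⊝₁ 𝟘₁) ⊛₁ ((ι₁ 1 ⊕₁ ⊝₁ 𝟘₁) ⊛₁ (ι₁ 1 ⊕₁ 𝟘₁)) ≋₁ ι₁ 1
      [1-0]²[1+0] = ℚxSolver.solve 0 ((con (+ 1) :+ :- con (+ 0)) :* ((con (+ 1) :+ :- con (+ 0)) :* (con (+ 1) :+ con (+ 0)))
                                      := con (+ 1)) ℚxR.refl

    egfV₀≋1 : at egfV 0 ≋₁ 𝟙₁
    egfV₀≋1 = mk≋₁ λ { zero → refl ; (suc i) → refl }

    E₀≋1 : at E 0 ≋₁ 𝟙₁
    E₀≋1 = mk≋₁ λ { zero → refl ; (suc i) → refl }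

    S₀≋1 : at S 0 ≋₁ 𝟙₁
    S₀≋1 = mk≋₁ λ i → P.trans (s₀≡1 i) (oneₛ≡𝟙₁ i)

    L₀≋1 : at L 0 ≋₁ 𝟙₁
    L₀≋1 = ℚxR.trans (ℚxR.*-cong egfV₀≋1 (ℚxR.*-cong ι₁1⊕𝟘≋𝟙 S₀≋1)) (ℚxR.trans (ℚxR.*-identityˡ _) (ℚxR.*-identityˡ _))
      where
      ι₁1⊕𝟘≋𝟙 : ι₁ 1 ⊕₁ 𝟘₁ ≋₁ 𝟙₁
      ι₁1⊕𝟘≋𝟙 = ℚxR.trans (ℚxR.+-identityʳ _) ι₁1≋𝟙

    Z₀≋0 : at Z 0 ≋₁ 𝟘₁
    Z₀≋0 = ℚxR.trans (ℚxR.+-cong L₀≋1 (ℚxR.-‿cong E₀≋1)) (ℚxR.-‿inverseʳ 𝟙₁)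

    Z≋0 : Z ≋ 𝟘
    Z≋0 = ode-unique odeCoeff (X ⊛ [1+τ]) Z odeCoeff₀≋1 Z-ode Z₀≋0

    L≋E : L ≋ E
    L≋E = ℚxtR.trans (sub-add L E) (ℚxtR.trans (ℚxtR.+-congʳ Z≋0) (ℚxtR.+-identityˡ E))

    egf*[1+t]s≈exp : (egf V *ₛ ((oneₛ +ₛ tₛ) *ₛ s)) ≈ₛ expₛ q
    egf*[1+t]s≈exp n i = un₁ (un (ℚxtR.trans (embed-*ₛ (egf V) _) (ℚxtR.trans (ℚxtR.*-congˡ (ℚxtR.trans (embed-*ₛ (oneₛ +ₛ tₛ) s) (ℚxtR.*-congʳ embed-[1+t]))) L≋E)) n) i



  egfV-identity : ∀ (q s : Ser) →
                  (q *ₛ (oneₛ -ₛ tₛ)) ≈ₛ (xₛ *ₛ tₛ) →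
                  (∀ i → s 0 i ≡ oneₛ 0 i) →
                  (s *ₛ s) ≈ₛ (oneₛ -ₛ tₛ *ₛ tₛ) →
                  (egf V *ₛ ((oneₛ +ₛ tₛ) *ₛ s)) ≈ₛ expₛ q
  egfV-identity = EgfIdentity.egf*[1+t]s≈exp


open HermiteDeterminant using (V)
open VCoefficients using (U≈ₚsubSqV; V-hasDegree; V-rec; V-coeff-pos)
open LowCoefficients using (a₀-even-closed; a₀-odd-closed; a₁-even; a₁-odd)
open GeneratingFunction using (egfV-identity)
open import Data.Integer using (_-_)
open P using (refl)

mainTheorem14 : Σ (ℕ → Poly) λ V →
    -- (1) U(n,x) = V(n,x²), deg V(n,x) = n-1
    (∀ n → 1 ≤ n → (U n ≈ₚ subSq (V n)) × HasDegree (V n) (n ∸ 1))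
    -- (2) initial values and recurrence
    × (V 1 ≈ₚ constₚ (+ 1))
    × (V 2 ≈ₚ (Xₚ -ₚ constₚ (+ 1)))
    × (V 3 ≈ₚ (Xₚ *ₚ Xₚ +ₚ constₚ (+ 3)))
    × (∀ n → 4 ≤ n →
         V n ≈ₚ ((Xₚ +ₚ constₚ (+ n - + 3)) *ₚ V (n ∸ 1)
                 +ₚ (+ n - + 2) ·ₚ ((Xₚ +ₚ constₚ (+ n)) *ₚ V (n ∸ 2))
                 -ₚ ((+ n - + 3) ℤ.* ((+ n - + 2) ℤ.* (+ n - + 2))) ·ₚ V (n ∸ 3)))
    -- (3) generating function: q = xt/(1-t), s = √(1-t²)
    × (∀ (q s : Ser) →
         (q *ₛ (oneₛ -ₛ tₛ)) ≈ₛ (xₛ *ₛ tₛ) →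
         (∀ i → s 0 i ≡ oneₛ 0 i) →
         (s *ₛ s) ≈ₛ (oneₛ -ₛ tₛ *ₛ tₛ) →
         (egf V *ₛ ((oneₛ +ₛ tₛ) *ₛ s)) ≈ₛ expₛ q)
    -- (4) coefficients a(i,n) = coeff (V n) i
    × (∀ n → 1 ≤ n →
         ℤ→ℚ (coeff (V (2 ℕ.* n)) 0)
           ≡ ℚ.- (factRatio (2 ℕ.* n) n ℚ.* factRatio (2 ℕ.* n) n))
    × (∀ n → 1 ≤ n →
         ℤ→ℚ (coeff (V (suc (2 ℕ.* n))) 0)
           ≡ (factRatio (suc (2 ℕ.* n)) n ℚ.* factRatio (suc (2 ℕ.* n)) n) /ℕ suc (2 ℕ.* n))
    × (∀ n → 1 ≤ n → coeff (V (2 ℕ.* n)) 1 ≡ ℤ.- coeff (V (2 ℕ.* n)) 0)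
    × (∀ n → 1 ≤ n → coeff (V (suc (2 ℕ.* n))) 1 ≡ + 0)
    × (∀ n i → 1 ≤ n → 2 ≤ i → i ≤ n ∸ 1 → + 0 ℤ.< coeff (V n) i)
mainTheorem14 =
  V , (λ n 1≤n → U≈ₚsubSqV n 1≤n , V-hasDegree n 1≤n)
    , (λ _ → refl) , (λ _ → refl) , (λ _ → refl) , V-rec
    , egfV-identity
    , a₀-even-closed , a₀-odd-closed , a₁-even , a₁-odd
    , V-coeff-pos
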